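{- Let $P$ be a finite interval order with key graph $G_P$. The linear system in the variables $\rho_1,\dots,\rho_n$ consisting of the cycle inequalities $\sum_{i\in A}\rho_i-\sum_{j\in B}\rho_j\le-\gamma$, one for each directed cycle of $G_P$ (loops included), is totally dual integral.
   Context: A finite partial order $P=([n],\prec)$ is an interval order if there are compact real intervals $I_x=[\ell_x,r_x]$ with $x\prec y$ iff $r_x<\ell_y$; write $x\parallel y$ if $x\ne y$ are incomparable. The canonical representation $[\ell_x,r_x]_{x\in[n]}$ of $P$ is the (unique) representation using the minimum number $m$ of distinct endpoints, placed at $0,\dots,m-1$. For $y\not\prec x$, the slack of $(x,y)$ there is $\ell_y-r_x-1$ if $x\prec y$, $r_y-\ell_x$ if $x\parallel y$, $r_x-\ell_x$ if $x=y$; slack-$0$ pairs are slack zero pairs, called cover pairs if $x\prec y$ and sharp pairs if $x\parallel y$. The key graph $G_P$ has vertex set $\{\rho_1,\dots,\rho_n\}$ and colored, weighted arcs, the weight being a linear inequality in variables $\ell_1,\dots,\ell_n,\rho_1,\dots,\rho_n$: a blue arc $\rho_x\to\rho_y$ of weight $\langle\ell_x+\rho_x+1\le\ell_y\rangle$ for each slack zero cover pair $(x,y)$; a red arc $\rho_x\to\rho_y$ of weight $\langle\ell_x\le\ell_y+\rho_y\rangle$ for each slack zero sharp pair $(x,y)$; a red loop at $\rho_x$ of weight $\langle-\rho_x\le0\rangle$ for each slack zero pair $(x,x)$. For a directed cycle $C$ (a loop being a cycle of length one), summing the weights of its arcs cancels all $\ell$-variables and yields its cycle inequality $\langle\gamma+\sum_{i\in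 A}\rho_i\le\sum_{j\in B}\rho_j\rangle$, where $\gamma$ is the number of blue arcs of $C$ and, for consecutive arcs $\rho_x\to\rho_y\to\rho_z$ of $C$, $y\in A$ if both are blue, $y\in B$ if both are red. A system $A\boldsymbol x\le\boldsymbol b$ is totally dual integral if for every integral $\boldsymbol c$ for which $\max\{\boldsymbol c^T\boldsymbol x:A\boldsymbol x\le\boldsymbol b\}$ is finite, $\min\{\boldsymbol b^T\boldsymbol y:A^T\boldsymbol y=\boldsymbol c,\boldsymbol y\ge0\}$ has an integral optimal solution.
   Formalization: In the definition of total dual integrality, the primal vector $\boldsymbol x$ and the dual vector $\boldsymbol y$ have rational entries. -}

module Defs where

open import Data.Nat as ℕ using (ℕ; zero; suc; _<_)
open import Data.Integer as ℤ using (ℤ; +_)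
open import Data.Rational as ℚ using (ℚ; _/_; 0ℚ)
open import Data.Fin using (Fin; zero; suc; fromℕ)
open import Data.Fin.Properties using (_≟_)
open import Data.List using (List; foldr)
open import Data.List.Relation.Unary.All using (All)
open import Data.Product using (Σ; ∃; _×_; _,_; proj₁; proj₂)
open import Data.Sum using (_⊎_)
open import Relation.Nullary using (¬_; yes; no)
open import Relation.Binary.PropositionalEquality using (_≡_; _≢_)
open import Function using (_⇔_)
open import Function.Definitions using (Injective)

∑ℤ : ∀ {n} → (Fin n → ℤ) → ℤ
∑ℤ {zero}  f = + 0
∑ℤ {suc n} f = f zero ℤ.+ ∑ℤ (λ i → f (suc i))

∑ℚ : ∀ {n} → (Fin n → ℚ) → ℚ
∑ℚ {zero}  f = 0ℚ
∑ℚ {suc n} f = f zero ℚ.+ ∑ℚ (λ i → f (suc i))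

⟦_⟧ : ℤ → ℚ
⟦ k ⟧ = k / 1

record LinSystem (n : ℕ) : Set₁ where
  field
    Row : Set
    A   : Row → Fin n → ℤ
    b   : Row → ℤ

module _ {n : ℕ} (S : LinSystem n) where
  open LinSystem S

  Feasible : (Fin n → ℚ) → Set
  Feasible x = ∀ ρ → ∑ℚ (λ j → ⟦ A ρ j ⟧ ℚ.* x j) ℚ.≤ ⟦ b ρ ⟧

  -- max { cᵀx : Ax ≤ b } is finite: feasible and bounded above
  MaxFinite : (Fin n → ℤ) → Set
  MaxFinite c = (∃ λ x → Feasible x)
              × (∃ λ M → ∀ x → Feasible x → ∑ℚ (λ j → ⟦ c j ⟧ ℚ.* x j) ℚ.≤ M)

  -- a dual vector y ≥ 0 is given by its (finite) support: a list of
  -- rows with their coefficients (repeated rows add up).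
  DualVec : Set
  DualVec = List (Row × ℚ)

  dualCol : DualVec → Fin n → ℚ
  dualCol ys j = foldr (λ p s → proj₂ p ℚ.* ⟦ A (proj₁ p) j ⟧ ℚ.+ s) 0ℚ ys

  dualObj : DualVec → ℚ
  dualObj ys = foldr (λ p s → proj₂ p ℚ.* ⟦ b (proj₁ p) ⟧ ℚ.+ s) 0ℚ ys

  DualFeasible : (Fin n → ℤ) → DualVec → Set
  DualFeasible c ys = All (λ p → 0ℚ ℚ.≤ proj₂ p) ys × (∀ j → dualCol ys j ≡ ⟦ c j ⟧)

  IntegralDual : DualVec → Set
  IntegralDual ys = All (λ p → ∃ λ k → proj₂ p ≡ ⟦ k ⟧) ys

  TotallyDualIntegral : Set
  TotallyDualIntegral =
    ∀ (c : Fin n → ℤ) → MaxFinite c →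
      ∃ λ ys → IntegralDual ys × DualFeasible c ys
             × (∀ ys′ → DualFeasible c ys′ → dualObj ys ℚ.≤ dualObj ys′)

-- Interval representations with integer endpoints: I_x = [ℓ x , r x]

IsRep : ∀ {n} → (ℓ r : Fin n → ℕ) → Set
IsRep ℓ r = ∀ x → ℓ x ℕ.≤ r x

Prec : ∀ {n} → (ℓ r : Fin n → ℕ) → Fin n → Fin n → Set
Prec ℓ r x y = r x < ℓ y

EndpointsExactly : ∀ {n} → (ℓ r : Fin n → ℕ) → ℕ → Set
EndpointsExactly ℓ r m =
  (∀ x → ℓ x < m × r x < m) ×
  (∀ k → k < m → ∃ λ x → ℓ x ≡ k ⊎ r x ≡ k)

IsCanonical : ∀ {n} → (ℓ r : Fin n → ℕ) → Set
IsCanonical {n} ℓ r =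
  IsRep ℓ r ×
  Σ ℕ λ m → EndpointsExactly ℓ r m ×
    (∀ (ℓ′ r′ : Fin n → ℕ) (m′ : ℕ) → IsRep ℓ′ r′ →
       (∀ x y → Prec ℓ r x y ⇔ Prec ℓ′ r′ x y) →
       EndpointsExactly ℓ′ r′ m′ → m ℕ.≤ m′)

-- Key graph G_P (w.r.t. a representation ℓ r), vertices ρ_x ↔ x : Fin n

data Colour : Set where
  blue red : Colour

data Arc {n} (ℓ r : Fin n → ℕ) (x y : Fin n) : Colour → Set where
  coverArc : Prec ℓ r x y → ℓ y ≡ suc (r x) → Arc ℓ r x y blue
  sharpArc : x ≢ y → ¬ Prec ℓ r x y → ¬ Prec ℓ r y x → r y ≡ ℓ x → Arc ℓ r x y red
  loopArc  : x ≡ y → r x ≡ ℓ x → Arc ℓ r x y red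

-- cyclic successor / predecessor on Fin (suc k)
next : ∀ {k} → Fin (suc k) → Fin (suc k)
next {zero}  i = zero
next {suc k} zero = suc zero
next {suc k} (suc i) with next {k} i
... | zero   = zero
... | suc j  = suc (suc j)

prev : ∀ {k} → Fin (suc k) → Fin (suc k)
prev {k} zero = fromℕ k
prev (suc i) = Data.Fin.inject₁ i

-- a directed cycle of G_P of length suc k: distinct vertices v_0 … v_k
-- with an arc v_i → v_{i+1 mod (k+1)}  (k = 0: a loop)
record Cycle {n} (ℓ r : Fin n → ℕ) : Set where
  field
    len    : ℕ
    vertex : Fin (suc len) → Fin n
    distinct : Injective _≡_ _≡_ vertex
    colour : Fin (suc len) → Colour
    arc    : ∀ i → Arc ℓ r (vertex i) (vertex (next i)) (colour i)

module _ {n} {ℓ r : Fin n → ℕ} (C : Cycle ℓ r) where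
  open Cycle C

  -- contribution of vertex v_i (between arcs i-1 and i):
  -- +1 if both blue (i ∈ A), -1 if both red (i ∈ B), 0 otherwise
  contrib : Fin (suc len) → ℤ
  contrib i with colour (prev i) | colour i
  ... | blue | blue = + 1
  ... | red  | red  = ℤ.- (+ 1)
  ... | _    | _    = + 0

  γ : ℤ
  γ = ∑ℤ (λ i → blueCount (colour i))
    where
    blueCount : Colour → ℤ
    blueCount blue = + 1
    blueCount red  = + 0

  -- coefficient of ρ_z in  ∑_{A} ρ - ∑_{B} ρ
  cycleCoeff : Fin n → ℤ
  cycleCoeff z = ∑ℤ (λ i → indicator (vertex i ≟ z) (contrib i))
    where
    indicator : ∀ {P : Set} → Relation.Nullary.Dec P → ℤ → ℤ
    indicator (yes _) a = a
    indicator (no _)  _ = + 0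

cycleSystem : ∀ {n} → (ℓ r : Fin n → ℕ) → LinSystem n
cycleSystem ℓ r = record
  { Row = Cycle ℓ r
  ; A   = λ C → cycleCoeff C
  ; b   = λ C → ℤ.- γ C
  }

-- With the canonical endpoints, ρ = r − ℓ satisfies every cycle inequality with equality: the
-- left endpoints are a potential with zero slack on every arc, since arcs are slack-zero pairs.
-- Hence all dual feasible vectors have the same objective, and it suffices to write every
-- bounded objective c as a sum of cycle rows.
--
-- Put ℓ x at position 2 ℓ x and r x at position 2 r x + 1 of a doubled line.  An arc of G_P joins
-- an interval with an endpoint at some position j to one with an endpoint at j + 1 (red for even
-- j, blue for odd j), so a cycle is a closed walk that visits each of its vertices x by arriving
-- at an endpoint of x and departing from one: x ∈ A jumps forward from 2 ℓ x to 2 r x + 1, x ∈ B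
-- jumps back.  Let cut P count, with weights |c x|, the backward minus the forward jumps over
-- position P.  If some cut P is negative, moving every endpoint beyond P to the right by t keeps
-- all cycle inequalities and raises the objective by −t · cut P, so the maximum is infinite.
-- Otherwise, as every point of a canonical representation is both a left and a right endpoint,
-- cut P idle visits can be placed at each position P; matching departures at j with arrivals at
-- j + 1 gives a balanced multiset of arcs with vector sum c, which splits into simple cycles.

module Submission where

open import Defs
open import Algebra.Properties.CommutativeSemigroup as CommSemigroupProps using ()
open import Algebra.Bundles using (AbelianGroup; CommutativeMonoid)
open import Data.Empty using (⊥; ⊥-elim)
open import Data.List using (List; []; _∷_; _++_; [_]; length; lookup; map; replicate; zipWith)
open import Data.List.Relation.Unary.All as All using (All; []; _∷_)
open import Data.List.Relation.Unary.All.Properties as AllP using (¬Any⇒All¬)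
open import Data.List.Relation.Unary.AllPairs using (AllPairs; []; _∷_)
import Data.List.Relation.Unary.AllPairs.Properties as AllPairs
open import Data.List.Relation.Unary.Any using (any?)
open import Data.List.Membership.Propositional using (find)
open import Data.List.Membership.Propositional.Properties using (∈-∃++; ∈-lookup)
import Data.List.Properties as ListP
import Data.List.Relation.Binary.Permutation.Propositional.Properties as ↭P
open import Data.List.Relation.Binary.Permutation.Propositional as ↭ using (_↭_)
open import Data.Product using (Σ; ∃; ∃₂; _×_; _,_; proj₁; proj₂)
open import Data.Sum using (_⊎_; inj₁; inj₂)
open import Data.Fin using (Fin; zero; suc; fromℕ; inject₁)
open import Data.Fin.Properties using (_≟_) renaming (any? to anyFin?)
open import Data.Integer as ℤ using (ℤ; +_; -[1+_]; _+_; _*_; -_; _-_; _≤_; _<_; +≤+; 0ℤ; 1ℤ)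
import Data.Integer.Properties as ℤP
open import Data.Integer.Tactic.RingSolver using (solve-∀)
open import Data.Nat as ℕ using (ℕ; zero; suc; z≤n; s≤s)
import Data.Nat.Properties as ℕP
open import Data.Nat.Coprimality using (1-coprimeTo)
import Data.Nat.Coprimality as Coprime
open import Data.Rational as ℚ using (ℚ; 0ℚ; mkℚ)
import Data.Rational.Properties as ℚP
open import Function using (_∘_; _⇔_; mk⇔)
open import Relation.Nullary using (Dec; yes; no; ¬_)
open import Relation.Binary.PropositionalEquality hiding ([_])

open import Algebra.Properties.Group (AbelianGroup.group ℤP.+-0-abelianGroup) using ()
  renaming (∙-cancelˡ to +-cancelˡ; ∙-cancelʳ to +-cancelʳ)
open CommSemigroupProps ℤP.+-commutativeSemigroup using () renaming (interchange to +-interchange)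
open CommSemigroupProps (CommutativeMonoid.commutativeSemigroup ℚP.+-0-commutativeMonoid) using () renaming (interchange to +-interchangeℚ)

*-distribʳ-minus : ∀ a b c → (a - b) * c ≡ a * c - b * c
*-distribʳ-minus = solve-∀

-- Finite sums and integers as rationals

∑-cong : ∀ {k} {f g : Fin k → ℤ} → (∀ i → f i ≡ g i) → ∑ℤ f ≡ ∑ℤ g
∑-cong {zero}  eq = refl
∑-cong {suc k} eq = cong₂ _+_ (eq zero) (∑-cong (eq ∘ suc))

∑-zero : ∀ k → ∑ℤ {k} (λ _ → 0ℤ) ≡ 0ℤ
∑-zero zero    = refl
∑-zero (suc k) = trans (ℤP.+-identityˡ _) (∑-zero k)

∑-distrib-+ : ∀ {k} (f g : Fin k → ℤ) → ∑ℤ (λ i → f i + g i) ≡ ∑ℤ f + ∑ℤ g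
∑-distrib-+ {zero}  f g = refl
∑-distrib-+ {suc k} f g =
  trans (cong (_+_ (f zero + g zero)) (∑-distrib-+ (f ∘ suc) (g ∘ suc)))
        (+-interchange (f zero) (g zero) (∑ℤ (f ∘ suc)) (∑ℤ (g ∘ suc)))

∑-distrib-neg : ∀ {k} (f : Fin k → ℤ) → ∑ℤ (λ i → - f i) ≡ - ∑ℤ f
∑-distrib-neg {zero}  f = refl
∑-distrib-neg {suc k} f =
  trans (cong (_+_ (- f zero)) (∑-distrib-neg (f ∘ suc))) (sym (ℤP.neg-distrib-+ (f zero) _))

∑-distrib-minus : ∀ {k} (f g : Fin k → ℤ) → ∑ℤ (λ i → f i - g i) ≡ ∑ℤ f - ∑ℤ g
∑-distrib-minus f g = trans (∑-distrib-+ f (-_ ∘ g)) (cong (_+_ (∑ℤ f)) (∑-distrib-neg g))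

*-distribˡ-∑ : ∀ {k} (a : ℤ) (f : Fin k → ℤ) → ∑ℤ (λ i → a * f i) ≡ a * ∑ℤ f
*-distribˡ-∑ {zero}  a f = sym (ℤP.*-zeroʳ a)
*-distribˡ-∑ {suc k} a f =
  trans (cong (_+_ (a * f zero)) (*-distribˡ-∑ a (f ∘ suc))) (sym (ℤP.*-distribˡ-+ a (f zero) _))

*-distribʳ-∑ : ∀ {k} (a : ℤ) (f : Fin k → ℤ) → ∑ℤ (λ i → f i * a) ≡ ∑ℤ f * a
*-distribʳ-∑ a f =
  trans (∑-cong (λ i → ℤP.*-comm (f i) a)) (trans (*-distribˡ-∑ a f) (ℤP.*-comm a _))

∑-mono-≤ : ∀ {k} {f g : Fin k → ℤ} → (∀ i → f i ≤ g i) → ∑ℤ f ≤ ∑ℤ g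
∑-mono-≤ {zero}  le = ℤP.≤-refl
∑-mono-≤ {suc k} le = ℤP.+-mono-≤ (le zero) (∑-mono-≤ (le ∘ suc))

∑-nonNeg : ∀ {k} {f : Fin k → ℤ} → (∀ i → 0ℤ ≤ f i) → 0ℤ ≤ ∑ℤ f
∑-nonNeg {k} {f} nonNeg = subst (_≤ ∑ℤ f) (∑-zero k) (∑-mono-≤ nonNeg)

∑-nonNeg-≤0⇒≡0 : ∀ {k} {f : Fin k → ℤ} → (∀ i → 0ℤ ≤ f i) → ∑ℤ f ≤ 0ℤ → ∀ i → f i ≡ 0ℤ
∑-nonNeg-≤0⇒≡0 {suc k} {f} nonNeg ∑≤0 zero = ℤP.≤-antisym (begin
  f zero              ≡⟨ ℤP.+-identityʳ (f zero) ⟨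
  f zero + 0ℤ         ≤⟨ ℤP.+-monoʳ-≤ (f zero) (∑-nonNeg (nonNeg ∘ suc)) ⟩
  ∑ℤ f                ≤⟨ ∑≤0 ⟩
  0ℤ                  ∎) (nonNeg zero)
  where open ℤP.≤-Reasoning
∑-nonNeg-≤0⇒≡0 {suc k} {f} nonNeg ∑≤0 (suc i) = ∑-nonNeg-≤0⇒≡0 (nonNeg ∘ suc) (begin
  ∑ℤ (f ∘ suc)        ≡⟨ ℤP.+-identityˡ _ ⟨
  0ℤ + ∑ℤ (f ∘ suc)   ≤⟨ ℤP.+-monoˡ-≤ _ (nonNeg zero) ⟩
  ∑ℤ f                ≤⟨ ∑≤0 ⟩
  0ℤ                  ∎) i
  where open ℤP.≤-Reasoning

∑-comm : ∀ {a b} (f : Fin a → Fin b → ℤ) → ∑ℤ (λ i → ∑ℤ (f i)) ≡ ∑ℤ (λ j → ∑ℤ (λ i → f i j))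
∑-comm {zero}  {b} f = sym (∑-zero b)
∑-comm {suc a} f =
  trans (cong (_+_ (∑ℤ (f zero))) (∑-comm (f ∘ suc))) (sym (∑-distrib-+ (f zero) _))

∑-init-last : ∀ {k} (f : Fin (suc k) → ℤ) → ∑ℤ f ≡ ∑ℤ (f ∘ inject₁) + f (fromℕ k)
∑-init-last {zero}  f = trans (ℤP.+-identityʳ (f zero)) (sym (ℤP.+-identityˡ (f zero)))
∑-init-last {suc k} f =
  trans (cong (_+_ (f zero)) (∑-init-last (f ∘ suc))) (sym (ℤP.+-assoc (f zero) _ _))

∑-reindex-prev : ∀ {k} (f : Fin (suc k) → ℤ) → ∑ℤ (f ∘ prev) ≡ ∑ℤ f
∑-reindex-prev {k} f = trans (ℤP.+-comm (f (fromℕ k)) _) (sym (∑-init-last f))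

indicator : ∀ {P : Set} → Dec P → ℤ → ℤ
indicator (yes _) a = a
indicator (no _)  _ = 0ℤ

δ : ∀ {n} → Fin n → Fin n → ℤ
δ x z = indicator (x ≟ z) 1ℤ

indicator-δ : ∀ {n} (x z : Fin n) a → indicator (x ≟ z) a ≡ δ x z * a
indicator-δ x z a with x ≟ z
... | yes _ = sym (ℤP.*-identityˡ a)
... | no  _ = sym (ℤP.*-zeroˡ a)

δ-self : ∀ {n} (x : Fin n) → δ x x ≡ 1ℤ
δ-self x with x ≟ x
... | yes _  = refl
... | no x≢x = ⊥-elim (x≢x refl)

δ-≢ : ∀ {n} {x z : Fin n} → x ≢ z → δ x z ≡ 0ℤ
δ-≢ {x = x} {z} x≢z with x ≟ z
... | yes x≡z = ⊥-elim (x≢z x≡z)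
... | no  _   = refl

δ-nonNeg : ∀ {n} (x z : Fin n) → 0ℤ ≤ δ x z
δ-nonNeg x z with x ≟ z
... | yes _ = +≤+ z≤n
... | no  _ = ℤP.≤-refl

δ-sym : ∀ {n} (x z : Fin n) → δ x z ≡ δ z x
δ-sym x z with x ≟ z
... | yes refl = sym (δ-self x)
... | no  x≢z  = sym (δ-≢ (x≢z ∘ sym))

δ-suc : ∀ {n} (x z : Fin n) → δ (suc x) (suc z) ≡ δ x z
δ-suc x z with x ≟ z
... | yes _ = refl
... | no  _ = refl

∑-δ : ∀ {n} (x : Fin n) (g : Fin n → ℤ) → ∑ℤ (λ z → δ x z * g z) ≡ g x
∑-δ {suc n} zero g = begin
  1ℤ * g zero + ∑ℤ (λ z → δ zero (suc z) * g (suc z)) ≡⟨ cong₂ _+_ (ℤP.*-identityˡ (g zero)) (∑-cong (λ z → ℤP.*-zeroˡ (g (suc z)))) ⟩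
  g zero + ∑ℤ {n} (λ _ → 0ℤ)                         ≡⟨ cong (_+_ (g zero)) (∑-zero n) ⟩
  g zero + 0ℤ                                         ≡⟨ ℤP.+-identityʳ (g zero) ⟩
  g zero                                              ∎
  where open ≡-Reasoning
∑-δ {suc n} (suc x) g = begin
  0ℤ * g zero + ∑ℤ (λ z → δ (suc x) (suc z) * g (suc z)) ≡⟨ cong₂ _+_ (ℤP.*-zeroˡ (g zero)) (∑-cong (λ z → cong (_* g (suc z)) (δ-suc x z))) ⟩
  0ℤ + ∑ℤ (λ z → δ x z * g (suc z))                      ≡⟨ ℤP.+-identityˡ _ ⟩
  ∑ℤ (λ z → δ x z * g (suc z))                           ≡⟨ ∑-δ x (g ∘ suc) ⟩
  g (suc x)                                              ∎
  where open ≡-Reasoning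

∑-δ′ : ∀ {n} (x : Fin n) (g : Fin n → ℤ) → ∑ℤ (λ y → g y * δ y x) ≡ g x
∑-δ′ x g = trans (∑-cong (λ y → trans (ℤP.*-comm (g y) (δ y x)) (cong (_* g y) (δ-sym y x)))) (∑-δ x g)

∑ℚ-cong : ∀ {k} {f g : Fin k → ℚ} → (∀ i → f i ≡ g i) → ∑ℚ f ≡ ∑ℚ g
∑ℚ-cong {zero}  eq = refl
∑ℚ-cong {suc k} eq = cong₂ ℚ._+_ (eq zero) (∑ℚ-cong (eq ∘ suc))

∑ℚ-zero : ∀ k → ∑ℚ {k} (λ _ → 0ℚ) ≡ 0ℚ
∑ℚ-zero zero    = refl
∑ℚ-zero (suc k) = trans (ℚP.+-identityˡ _) (∑ℚ-zero k)

∑ℚ-distrib-+ : ∀ {k} (f g : Fin k → ℚ) → ∑ℚ (λ i → f i ℚ.+ g i) ≡ ∑ℚ f ℚ.+ ∑ℚ g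
∑ℚ-distrib-+ {zero}  f g = refl
∑ℚ-distrib-+ {suc k} f g =
  trans (cong (ℚ._+_ (f zero ℚ.+ g zero)) (∑ℚ-distrib-+ (f ∘ suc) (g ∘ suc)))
        (+-interchangeℚ (f zero) (g zero) (∑ℚ (f ∘ suc)) (∑ℚ (g ∘ suc)))

*-distribˡ-∑ℚ : ∀ {k} (a : ℚ) (f : Fin k → ℚ) → ∑ℚ (λ i → a ℚ.* f i) ≡ a ℚ.* ∑ℚ f
*-distribˡ-∑ℚ {zero}  a f = sym (ℚP.*-zeroʳ a)
*-distribˡ-∑ℚ {suc k} a f =
  trans (cong (ℚ._+_ (a ℚ.* f zero)) (*-distribˡ-∑ℚ a (f ∘ suc))) (sym (ℚP.*-distribˡ-+ a (f zero) _))

-- ⟦ a ⟧ = a / 1 goes through normalisation; ⟦ a ⟧′ is the same number in normal form, on which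
-- ℚ's operations compute.
private
  ⟦_⟧′ : ℤ → ℚ
  ⟦ a ⟧′ = mkℚ a 0 (Coprime.sym (1-coprimeTo ℤ.∣ a ∣))

  ⟦⟧≡⟦⟧′ : ∀ a → ⟦ a ⟧ ≡ ⟦ a ⟧′
  ⟦⟧≡⟦⟧′ (+ n)    = ℚP.normalize-coprime (Coprime.sym (1-coprimeTo n))
  ⟦⟧≡⟦⟧′ -[1+ n ] = cong ℚ.-_ (ℚP.normalize-coprime (Coprime.sym (1-coprimeTo (suc n))))

⟦⟧-+ : ∀ a b → ⟦ a ⟧ ℚ.+ ⟦ b ⟧ ≡ ⟦ a + b ⟧
⟦⟧-+ a b rewrite ⟦⟧≡⟦⟧′ a | ⟦⟧≡⟦⟧′ b =
  ℚP./-cong (cong₂ _+_ (ℤP.*-identityʳ a) (ℤP.*-identityʳ b)) refl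

⟦⟧-* : ∀ a b → ⟦ a ⟧ ℚ.* ⟦ b ⟧ ≡ ⟦ a * b ⟧
⟦⟧-* a b rewrite ⟦⟧≡⟦⟧′ a | ⟦⟧≡⟦⟧′ b = refl

⟦⟧-mono-≤ : ∀ {a b} → a ≤ b → ⟦ a ⟧ ℚ.≤ ⟦ b ⟧
⟦⟧-mono-≤ {a} {b} a≤b rewrite ⟦⟧≡⟦⟧′ a | ⟦⟧≡⟦⟧′ b =
  ℚ.*≤* (subst₂ _≤_ (sym (ℤP.*-identityʳ a)) (sym (ℤP.*-identityʳ b)) a≤b)

⟦⟧-cancel-≤ : ∀ {a b} → ⟦ a ⟧ ℚ.≤ ⟦ b ⟧ → a ≤ b
⟦⟧-cancel-≤ {a} {b} ⟦a⟧≤⟦b⟧ rewrite ⟦⟧≡⟦⟧′ a | ⟦⟧≡⟦⟧′ b with ⟦a⟧≤⟦b⟧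
... | ℚ.*≤* a*1≤b*1 = subst₂ _≤_ (ℤP.*-identityʳ a) (ℤP.*-identityʳ b) a*1≤b*1

∑ℚ-⟦⟧ : ∀ {k} (f : Fin k → ℤ) → ∑ℚ (λ i → ⟦ f i ⟧) ≡ ⟦ ∑ℤ f ⟧
∑ℚ-⟦⟧ {zero}  f = refl
∑ℚ-⟦⟧ {suc k} f = trans (cong (ℚ._+_ ⟦ f zero ⟧) (∑ℚ-⟦⟧ (f ∘ suc))) (⟦⟧-+ (f zero) _)

∑ℚ-⟦⟧-* : ∀ {k} (f g : Fin k → ℤ) → ∑ℚ (λ i → ⟦ f i ⟧ ℚ.* ⟦ g i ⟧) ≡ ⟦ ∑ℤ (λ i → f i * g i) ⟧
∑ℚ-⟦⟧-* f g = trans (∑ℚ-cong (λ i → ⟦⟧-* (f i) (g i))) (∑ℚ-⟦⟧ (λ i → f i * g i))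

i≤+∣i∣ : ∀ i → i ≤ + ℤ.∣ i ∣
i≤+∣i∣ (+ _)    = ℤP.≤-refl
i≤+∣i∣ -[1+ _ ] = ℤ.-≤+

≤⟦∣↥∣⟧ : ∀ (q : ℚ) → q ℚ.≤ ⟦ + ℤ.∣ ℚ.↥ q ∣ ⟧
≤⟦∣↥∣⟧ (mkℚ num d-1 _) rewrite ⟦⟧≡⟦⟧′ (+ ℤ.∣ num ∣) = ℚ.*≤* (begin
  num * + 1                 ≡⟨ ℤP.*-identityʳ num ⟩
  num                       ≤⟨ i≤+∣i∣ num ⟩
  + ℤ.∣ num ∣               ≤⟨ +≤+ (ℕP.m≤m*n ℤ.∣ num ∣ (suc d-1)) ⟩
  + (ℤ.∣ num ∣ ℕ.* suc d-1) ≡⟨ ℤP.pos-* ℤ.∣ num ∣ (suc d-1) ⟩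
  + ℤ.∣ num ∣ * + suc d-1   ∎)
  where open ℤP.≤-Reasoning

∑ˡ : ∀ {A : Set} → (A → ℤ) → List A → ℤ
∑ˡ f []       = 0ℤ
∑ˡ f (x ∷ xs) = f x + ∑ˡ f xs

module _ {A : Set} where

  ∑ˡ-cong : ∀ {f g : A → ℤ} (xs : List A) → (∀ a → f a ≡ g a) → ∑ˡ f xs ≡ ∑ˡ g xs
  ∑ˡ-cong []       eq = refl
  ∑ˡ-cong (x ∷ xs) eq = cong₂ _+_ (eq x) (∑ˡ-cong xs eq)

  ∑ˡ-++ : ∀ (f : A → ℤ) xs ys → ∑ˡ f (xs ++ ys) ≡ ∑ˡ f xs + ∑ˡ f ys
  ∑ˡ-++ f []       ys = sym (ℤP.+-identityˡ _)
  ∑ˡ-++ f (x ∷ xs) ys = trans (cong (_+_ (f x)) (∑ˡ-++ f xs ys)) (sym (ℤP.+-assoc (f x) _ _))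

  ∑ˡ-↭ : ∀ (f : A → ℤ) {xs ys} → xs ↭ ys → ∑ˡ f xs ≡ ∑ˡ f ys
  ∑ˡ-↭ f ↭.refl              = refl
  ∑ˡ-↭ f (↭.prep x p)        = cong (_+_ (f x)) (∑ˡ-↭ f p)
  ∑ˡ-↭ f (↭.swap x y p)      = trans (cong (λ t → f x + (f y + t)) (∑ˡ-↭ f p)) (swapFront (f x) (f y) _)
    where
    swapFront : ∀ a b c → a + (b + c) ≡ b + (a + c)
    swapFront = solve-∀
  ∑ˡ-↭ f (↭.trans p q)       = trans (∑ˡ-↭ f p) (∑ˡ-↭ f q)

  ∑ˡ-All-cong : ∀ {P : A → Set} {f g : A → ℤ} xs → All P xs → (∀ a → P a → f a ≡ g a) → ∑ˡ f xs ≡ ∑ˡ g xs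
  ∑ˡ-All-cong []       []         eq = refl
  ∑ˡ-All-cong (x ∷ xs) (px ∷ pxs) eq = cong₂ _+_ (eq x px) (∑ˡ-All-cong xs pxs eq)

  ∑ˡ-↭-++ : ∀ (f : A → ℤ) {M} K R → M ↭ K ++ R → ∑ˡ f M ≡ ∑ˡ f K + ∑ˡ f R
  ∑ˡ-↭-++ f K R M↭K++R = trans (∑ˡ-↭ f M↭K++R) (∑ˡ-++ f K R)

  ↭-++-length-< : ∀ {M : List A} x K R → M ↭ (x ∷ K) ++ R → length R ℕ.< length M
  ↭-++-length-< x K R M↭ = subst (length R ℕ.<_) (sym (↭P.↭-length M↭))
    (s≤s (subst (length R ℕ.≤_) (sym (ListP.length-++ K)) (ℕP.m≤n+m (length R) (length K))))

  ∑ˡ-lookup : ∀ (f : A → ℤ) xs → ∑ℤ (f ∘ lookup xs) ≡ ∑ˡ f xs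
  ∑ˡ-lookup f []       = refl
  ∑ˡ-lookup f (x ∷ xs) = cong (_+_ (f x)) (∑ˡ-lookup f xs)

  ∑ˡ-nonNeg : ∀ {f : A → ℤ} xs → (∀ a → 0ℤ ≤ f a) → 0ℤ ≤ ∑ˡ f xs
  ∑ˡ-nonNeg []       _      = ℤP.≤-refl
  ∑ˡ-nonNeg (x ∷ xs) nonNeg = ℤP.+-mono-≤ (nonNeg x) (∑ˡ-nonNeg xs nonNeg)

  ∑ˡ-distrib-+ : ∀ (f g : A → ℤ) xs → ∑ˡ (λ a → f a + g a) xs ≡ ∑ˡ f xs + ∑ˡ g xs
  ∑ˡ-distrib-+ f g []       = refl
  ∑ˡ-distrib-+ f g (x ∷ xs) =
    trans (cong (_+_ (f x + g x)) (∑ˡ-distrib-+ f g xs)) (+-interchange (f x) (g x) (∑ˡ f xs) (∑ˡ g xs))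

  ∑ˡ-replicate : ∀ (f : A → ℤ) k a → ∑ˡ f (replicate k a) ≡ + k * f a
  ∑ˡ-replicate f zero    a = sym (ℤP.*-zeroˡ (f a))
  ∑ˡ-replicate f (suc k) a = trans (cong (_+_ (f a)) (∑ˡ-replicate f k a)) (sym (ℤP.suc-* (+ k) (f a)))

  ∑ˡ-const-1 : ∀ (xs : List A) → ∑ˡ (λ _ → 1ℤ) xs ≡ + length xs
  ∑ˡ-const-1 []       = refl
  ∑ˡ-const-1 (x ∷ xs) = trans (cong (_+_ 1ℤ) (∑ˡ-const-1 xs)) (sym (ℤP.pos-+ 1 (length xs)))

∑ˡ-zipWith : ∀ {A B C : Set} (_⊕_ : A → B → C) (F : C → ℤ) (f : A → ℤ) (g : B → ℤ) →
             (∀ a b → F (a ⊕ b) ≡ f a + g b) →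
             ∀ as bs → length as ≡ length bs → ∑ˡ F (zipWith _⊕_ as bs) ≡ ∑ˡ f as + ∑ˡ g bs
∑ˡ-zipWith _⊕_ F f g F≡ []       []       _   = refl
∑ˡ-zipWith _⊕_ F f g F≡ (a ∷ as) (b ∷ bs) len =
  trans (cong₂ _+_ (F≡ a b) (∑ˡ-zipWith _⊕_ F f g F≡ as bs (ℕP.suc-injective len)))
        (+-interchange (f a) (g b) (∑ˡ f as) (∑ˡ g bs))

module _ {A : Set} where

  replicateEach : ∀ {k} → (Fin k → ℕ) → (Fin k → A) → List A
  replicateEach {zero}  μ e = []
  replicateEach {suc k} μ e = replicate (μ zero) (e zero) ++ replicateEach (μ ∘ suc) (e ∘ suc)

  ∑ˡ-replicateEach : ∀ {k} (f : A → ℤ) (μ : Fin k → ℕ) e → ∑ˡ f (replicateEach μ e) ≡ ∑ℤ (λ x → + μ x * f (e x))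
  ∑ˡ-replicateEach {zero}  f μ e = refl
  ∑ˡ-replicateEach {suc k} f μ e = trans (∑ˡ-++ f (replicate (μ zero) (e zero)) _)
    (cong₂ _+_ (∑ˡ-replicate f (μ zero) (e zero)) (∑ˡ-replicateEach f (μ ∘ suc) (e ∘ suc)))

  All-replicate : ∀ {P : A → Set} k a → k ≡ 0 ⊎ P a → All P (replicate k a)
  All-replicate k a (inj₁ refl) = []
  All-replicate k a (inj₂ pa)   = AllP.replicate⁺ k pa

  All-replicateEach : ∀ {k} {P : A → Set} (μ : Fin k → ℕ) e → (∀ x → μ x ≡ 0 ⊎ P (e x)) → All P (replicateEach μ e)
  All-replicateEach {zero}  μ e _      = []
  All-replicateEach {suc k} μ e zeroOrP =
    AllP.++⁺ (All-replicate (μ zero) (e zero) (zeroOrP zero)) (All-replicateEach (μ ∘ suc) (e ∘ suc) (zeroOrP ∘ suc))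

-- Linear systems with a tight point

module _ {n} (S : LinSystem n) where
  open LinSystem S

  Tight : (Fin n → ℚ) → Set
  Tight x = ∀ ρ → ∑ℚ (λ j → ⟦ A ρ j ⟧ ℚ.* x j) ≡ ⟦ b ρ ⟧

  Feasible-⟦⟧ : ∀ {w} → (∀ ρ → ∑ℤ (λ j → A ρ j * w j) ≤ b ρ) → Feasible S (⟦_⟧ ∘ w)
  Feasible-⟦⟧ {w} ineq ρ = subst (ℚ._≤ ⟦ b ρ ⟧) (sym (∑ℚ-⟦⟧-* (A ρ) w)) (⟦⟧-mono-≤ (ineq ρ))

  Tight-⟦⟧ : ∀ {w} → (∀ ρ → ∑ℤ (λ j → A ρ j * w j) ≡ b ρ) → Tight (⟦_⟧ ∘ w)
  Tight-⟦⟧ {w} eq ρ = trans (∑ℚ-⟦⟧-* (A ρ) w) (cong ⟦_⟧ (eq ρ))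

  RowSum : List Row → (Fin n → ℤ) → Set
  RowSum ρs c = ∀ j → ∑ˡ (λ ρ → A ρ j) ρs ≡ c j

  dualObj-at-tight : ∀ {x} → Tight x → ∀ ys → dualObj S ys ≡ ∑ℚ (λ j → dualCol S ys j ℚ.* x j)
  dualObj-at-tight {x} tight [] = sym (trans (∑ℚ-cong (λ j → ℚP.*-zeroˡ (x j))) (∑ℚ-zero n))
  dualObj-at-tight {x} tight ((ρ , q) ∷ ys) = sym (begin
    ∑ℚ (λ j → (q ℚ.* ⟦ A ρ j ⟧ ℚ.+ dualCol S ys j) ℚ.* x j)
      ≡⟨ ∑ℚ-cong (λ j → ℚP.*-distribʳ-+ (x j) (q ℚ.* ⟦ A ρ j ⟧) (dualCol S ys j)) ⟩
    ∑ℚ (λ j → q ℚ.* ⟦ A ρ j ⟧ ℚ.* x j ℚ.+ dualCol S ys j ℚ.* x j)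
      ≡⟨ ∑ℚ-distrib-+ (λ j → q ℚ.* ⟦ A ρ j ⟧ ℚ.* x j) (λ j → dualCol S ys j ℚ.* x j) ⟩
    ∑ℚ (λ j → q ℚ.* ⟦ A ρ j ⟧ ℚ.* x j) ℚ.+ ∑ℚ (λ j → dualCol S ys j ℚ.* x j)
      ≡⟨ cong₂ ℚ._+_ rowTerm (sym (dualObj-at-tight tight ys)) ⟩
    q ℚ.* ⟦ b ρ ⟧ ℚ.+ dualObj S ys
      ∎)
    where
    open ≡-Reasoning
    rowTerm : ∑ℚ (λ j → q ℚ.* ⟦ A ρ j ⟧ ℚ.* x j) ≡ q ℚ.* ⟦ b ρ ⟧
    rowTerm = begin
      ∑ℚ (λ j → q ℚ.* ⟦ A ρ j ⟧ ℚ.* x j)   ≡⟨ ∑ℚ-cong (λ j → ℚP.*-assoc q ⟦ A ρ j ⟧ (x j)) ⟩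
      ∑ℚ (λ j → q ℚ.* (⟦ A ρ j ⟧ ℚ.* x j)) ≡⟨ *-distribˡ-∑ℚ q (λ j → ⟦ A ρ j ⟧ ℚ.* x j) ⟩
      q ℚ.* ∑ℚ (λ j → ⟦ A ρ j ⟧ ℚ.* x j)   ≡⟨ cong (ℚ._*_ q) (tight ρ) ⟩
      q ℚ.* ⟦ b ρ ⟧                        ∎

  dualFeasible⇒optimal : ∀ {x c ys ys′} → Tight x → DualFeasible S c ys → DualFeasible S c ys′ →
                         dualObj S ys ℚ.≤ dualObj S ys′
  dualFeasible⇒optimal {x} {c} {ys} {ys′} tight (_ , cols) (_ , cols′) = ℚP.≤-reflexive (begin
    dualObj S ys                                ≡⟨ dualObj-at-tight tight ys ⟩
    ∑ℚ (λ j → dualCol S ys j ℚ.* x j)           ≡⟨ ∑ℚ-cong (λ j → cong (ℚ._* x j) (trans (cols j) (sym (cols′ j)))) ⟩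
    ∑ℚ (λ j → dualCol S ys′ j ℚ.* x j)          ≡⟨ dualObj-at-tight tight ys′ ⟨
    dualObj S ys′                               ∎)
    where open ≡-Reasoning

  unitDual : List Row → DualVec S
  unitDual = map (_, ℚ.1ℚ)

  unitDual-integral : ∀ ρs → IntegralDual S (unitDual ρs)
  unitDual-integral []       = []
  unitDual-integral (_ ∷ ρs) = (1ℤ , refl) ∷ unitDual-integral ρs

  unitDual-nonNeg : ∀ ρs → All (λ p → 0ℚ ℚ.≤ proj₂ p) (unitDual ρs)
  unitDual-nonNeg []       = []
  unitDual-nonNeg (_ ∷ ρs) = ⟦⟧-mono-≤ {0ℤ} {1ℤ} (+≤+ z≤n) ∷ unitDual-nonNeg ρs

  dualCol-unitDual : ∀ ρs j → dualCol S (unitDual ρs) j ≡ ⟦ ∑ˡ (λ ρ → A ρ j) ρs ⟧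
  dualCol-unitDual []       j = refl
  dualCol-unitDual (ρ ∷ ρs) j =
    trans (cong₂ ℚ._+_ (ℚP.*-identityˡ ⟦ A ρ j ⟧) (dualCol-unitDual ρs j)) (⟦⟧-+ (A ρ j) _)

  tight∧rowSums⇒TDI : ∀ {x} → Tight x → (∀ c → MaxFinite S c → ∃ λ ρs → RowSum ρs c) →
                      TotallyDualIntegral S
  tight∧rowSums⇒TDI tight rowSums c bounded =
    unitDual ρs , unitDual-integral ρs , feasible , λ _ → dualFeasible⇒optimal {c = c} tight feasible
    where
    ρs = proj₁ (rowSums c bounded)
    feasible : DualFeasible S c (unitDual ρs)
    feasible = unitDual-nonNeg ρs , λ j → trans (dualCol-unitDual ρs j) (cong ⟦_⟧ (proj₂ (rowSums c bounded) j))

-- Cycle inequalities from potentials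

next-fromℕ : ∀ k → next (fromℕ k) ≡ zero
next-fromℕ zero = refl
next-fromℕ (suc k) with next (fromℕ k) | next-fromℕ k
... | zero | _ = refl

next-inject₁ : ∀ {k} (i : Fin k) → next (inject₁ i) ≡ suc i
next-inject₁ {suc k} zero = refl
next-inject₁ {suc k} (suc i) with next (inject₁ i) | next-inject₁ i
... | suc _ | refl = refl

next-prev : ∀ {k} (i : Fin (suc k)) → next (prev i) ≡ i
next-prev {k} zero = next-fromℕ k
next-prev (suc i) = next-inject₁ i

prev-next : ∀ {k} (i : Fin (suc k)) → prev (next i) ≡ i
prev-next {zero}  zero = refl
prev-next {suc k} zero = refl
prev-next {suc k} (suc i) with next i | prev-next i
... | zero  | eq = cong suc eq
... | suc _ | eq = cong suc eq

∑-cyclic-difference : ∀ {k} (g : Fin (suc k) → ℤ) → ∑ℤ (λ i → g (next i) - g i) ≡ 0ℤ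
∑-cyclic-difference g = begin
  ∑ℤ (λ i → g (next i) - g i)        ≡⟨ ∑-distrib-minus (g ∘ next) g ⟩
  ∑ℤ (g ∘ next) - ∑ℤ g               ≡⟨ cong (λ t → t - ∑ℤ g) (∑-reindex-prev (g ∘ next)) ⟨
  ∑ℤ (g ∘ next ∘ prev) - ∑ℤ g        ≡⟨ cong (λ t → t - ∑ℤ g) (∑-cong (cong g ∘ next-prev)) ⟩
  ∑ℤ g - ∑ℤ g                        ≡⟨ ℤP.+-inverseʳ (∑ℤ g) ⟩
  0ℤ                                 ∎
  where open ≡-Reasoning

isBlue isRed : Colour → ℤ
isBlue blue = 1ℤ
isBlue red  = 0ℤ
isRed blue = 0ℤ
isRed red  = 1ℤ

-- The slack at ℓ = π, ρ = w of the weight of an arc x → y of G_P.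
arcSlack : ∀ {n} (π w : Fin n → ℤ) → Colour → Fin n → Fin n → ℤ
arcSlack π w blue x y = π y - (π x + w x + 1ℤ)
arcSlack π w red  x y = (π y + w y) - π x

module _ {n} {ℓ r : Fin n → ℕ} (C : Cycle ℓ r) where
  open Cycle C

  -- `cycleCoeff` and `γ` sum functions that are local to Defs and cannot be named here.  The
  -- metavariables below are solved to them by unification, which becomes a higher-order pattern
  -- problem once `_≡_`, `_≟_` and `colour` are abstracted.
  private
    module CoeffUnfolding (z : Fin n) where
      mutual
        tail : (_∼_ : Fin n → Fin n → Set) → (∀ x y → Dec (x ∼ y)) → Fin len → ℤ
        tail = _
        unfold : cycleCoeff C z ≡ indicator (vertex zero ≟ z) (contrib C zero) + ∑ℤ (tail _≡_ _≟_)
        unfold with _≡_ {A = Fin n} | _≟_ {n}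
        ... | _ | _≟′_ with vertex zero ≟′ z
        ... | yes _ = refl
        ... | no  _ = refl

      tail-indicator : ∀ {P : Set} (d : Dec P) i → tail (λ _ _ → P) (λ _ _ → d) i ≡ indicator d (contrib C (suc i))
      tail-indicator (yes _) i = refl
      tail-indicator (no _)  i = refl

  cycleCoeff-as-sum : ∀ z → cycleCoeff C z ≡ ∑ℤ (λ i → δ (vertex i) z * contrib C i)
  cycleCoeff-as-sum z = begin
    cycleCoeff C z                                          ≡⟨ unfold ⟩
    indicator (vertex zero ≟ z) (contrib C zero) + ∑ℤ (tail _≡_ _≟_)
      ≡⟨ cong (_+_ (indicator (vertex zero ≟ z) (contrib C zero))) (∑-cong (λ i → tail-indicator (vertex (suc i) ≟ z) i)) ⟩
    ∑ℤ (λ i → indicator (vertex i ≟ z) (contrib C i))      ≡⟨ ∑-cong (λ i → indicator-δ (vertex i) z (contrib C i)) ⟩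
    ∑ℤ (λ i → δ (vertex i) z * contrib C i)                 ∎
    where
    open CoeffUnfolding z
    open ≡-Reasoning

  private
    module BlueCountUnfolding where
      mutual
        tail : (Fin (suc len) → Colour) → Fin len → ℤ
        tail = _
        unfold : γ C ≡ isBlue (colour zero) + ∑ℤ (tail colour)
        unfold with colour
        ... | col with col zero
        ... | blue = refl
        ... | red  = refl

      tail-isBlue : ∀ c i → tail (λ _ → c) i ≡ isBlue c
      tail-isBlue blue i = refl
      tail-isBlue red  i = refl

  γ-as-sum : γ C ≡ ∑ℤ (isBlue ∘ colour)
  γ-as-sum = trans unfold (cong (_+_ (isBlue (colour zero))) (∑-cong (λ i → tail-isBlue (colour (suc i)) i)))
    where open BlueCountUnfolding

  contrib-as-difference : ∀ i → contrib C i ≡ isBlue (colour i) - isRed (colour (prev i))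
  contrib-as-difference i with colour (prev i) | colour i
  ... | blue | blue = refl
  ... | blue | red  = refl
  ... | red  | blue = refl
  ... | red  | red  = refl

  arcTerm : (Fin n → ℤ) → Fin (suc len) → ℤ
  arcTerm w i = isBlue (colour i) * w (vertex i) - isRed (colour i) * w (vertex (next i))

  ∑-cycleCoeff-*-as-vertexSum : ∀ (w : Fin n → ℤ) → ∑ℤ (λ z → cycleCoeff C z * w z) ≡ ∑ℤ (λ i → contrib C i * w (vertex i))
  ∑-cycleCoeff-*-as-vertexSum w = begin
    ∑ℤ (λ z → cycleCoeff C z * w z)
      ≡⟨ ∑-cong (λ z → cong (_* w z) (cycleCoeff-as-sum z)) ⟩
    ∑ℤ (λ z → ∑ℤ (λ i → δ (vertex i) z * contrib C i) * w z)
      ≡⟨ ∑-cong (λ z → sym (*-distribʳ-∑ (w z) (λ i → δ (vertex i) z * contrib C i))) ⟩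
    ∑ℤ (λ z → ∑ℤ (λ i → δ (vertex i) z * contrib C i * w z))
      ≡⟨ ∑-comm (λ z i → δ (vertex i) z * contrib C i * w z) ⟩
    ∑ℤ (λ i → ∑ℤ (λ z → δ (vertex i) z * contrib C i * w z))
      ≡⟨ ∑-cong (λ i → ∑-cong (λ z → ℤP.*-assoc (δ (vertex i) z) (contrib C i) (w z))) ⟩
    ∑ℤ (λ i → ∑ℤ (λ z → δ (vertex i) z * (contrib C i * w z)))
      ≡⟨ ∑-cong (λ i → ∑-δ (vertex i) (λ z → contrib C i * w z)) ⟩
    ∑ℤ (λ i → contrib C i * w (vertex i))
      ∎
    where open ≡-Reasoning

  vertexSum-as-arcSum : ∀ (w : Fin n → ℤ) → ∑ℤ (λ i → contrib C i * w (vertex i)) ≡ ∑ℤ (arcTerm w)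
  vertexSum-as-arcSum w = begin
    ∑ℤ (λ i → contrib C i * w (vertex i))
      ≡⟨ ∑-cong vertexTerm ⟩
    ∑ℤ (λ i → blueTerm i - redTerm (prev i))
      ≡⟨ ∑-distrib-minus blueTerm (redTerm ∘ prev) ⟩
    ∑ℤ blueTerm - ∑ℤ (redTerm ∘ prev)
      ≡⟨ cong (_-_ (∑ℤ blueTerm)) (∑-reindex-prev redTerm) ⟩
    ∑ℤ blueTerm - ∑ℤ redTerm
      ≡⟨ ∑-distrib-minus blueTerm redTerm ⟨
    ∑ℤ (arcTerm w)
      ∎
    where
    open ≡-Reasoning
    blueTerm redTerm : Fin (suc len) → ℤ
    blueTerm i = isBlue (colour i) * w (vertex i)
    redTerm  i = isRed (colour i) * w (vertex (next i))

    vertexTerm : ∀ i → contrib C i * w (vertex i) ≡ blueTerm i - redTerm (prev i)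
    vertexTerm i = begin
      contrib C i * w (vertex i)
        ≡⟨ cong (_* w (vertex i)) (contrib-as-difference i) ⟩
      (isBlue (colour i) - isRed (colour (prev i))) * w (vertex i)
        ≡⟨ *-distribʳ-minus (isBlue (colour i)) (isRed (colour (prev i))) (w (vertex i)) ⟩
      blueTerm i - isRed (colour (prev i)) * w (vertex i)
        ≡⟨ cong (λ j → blueTerm i - isRed (colour (prev i)) * w (vertex j)) (next-prev i) ⟨
      blueTerm i - redTerm (prev i)
        ∎

  ∑-cycleCoeff-* : ∀ (w : Fin n → ℤ) → ∑ℤ (λ z → cycleCoeff C z * w z) ≡ ∑ℤ (arcTerm w)
  ∑-cycleCoeff-* w = trans (∑-cycleCoeff-*-as-vertexSum w) (vertexSum-as-arcSum w)

  cycleCoeff-as-arcSum : ∀ z → cycleCoeff C z ≡ ∑ℤ (arcTerm (λ x → δ x z))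
  cycleCoeff-as-arcSum z = trans (sym (∑-δ′ z (cycleCoeff C))) (∑-cycleCoeff-* (λ x → δ x z))

  arcSlackAt : (π w : Fin n → ℤ) → Fin (suc len) → ℤ
  arcSlackAt π w i = arcSlack π w (colour i) (vertex i) (vertex (next i))

  arcTerm+slack : ∀ π w i →
    arcTerm w i + isBlue (colour i) + arcSlackAt π w i ≡ π (vertex (next i)) - π (vertex i)
  arcTerm+slack π w i with colour i
  ... | blue = blueCase (w (vertex i)) (w (vertex (next i))) (π (vertex i)) (π (vertex (next i)))
    where
    blueCase : ∀ wx wy πx πy → 1ℤ * wx - 0ℤ * wy + 1ℤ + (πy - (πx + wx + 1ℤ)) ≡ πy - πx
    blueCase = solve-∀
  ... | red = redCase (w (vertex i)) (w (vertex (next i))) (π (vertex i)) (π (vertex (next i)))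
    where
    redCase : ∀ wx wy πx πy → 0ℤ * wx - 1ℤ * wy + 0ℤ + (πy + wy - πx) ≡ πy - πx
    redCase = solve-∀

  cycle-slack : ∀ π w → ∑ℤ (λ z → cycleCoeff C z * w z) + ∑ℤ (arcSlackAt π w) ≡ - γ C
  cycle-slack π w = begin
    ∑ℤ (λ z → cycleCoeff C z * w z) + ∑ℤ (arcSlackAt π w)
      ≡⟨ cong (_+ ∑ℤ (arcSlackAt π w)) (∑-cycleCoeff-* w) ⟩
    ∑ℤ (arcTerm w) + ∑ℤ (arcSlackAt π w)
      ≡⟨ a+s≡a+g+s-g (∑ℤ (arcTerm w)) (∑ℤ (isBlue ∘ colour)) (∑ℤ (arcSlackAt π w)) ⟩
    ∑ℤ (arcTerm w) + ∑ℤ (isBlue ∘ colour) + ∑ℤ (arcSlackAt π w) - ∑ℤ (isBlue ∘ colour)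
      ≡⟨ cong₂ _-_ (sym ∑-arcTerm+slack) (sym γ-as-sum) ⟩
    ∑ℤ (λ i → arcTerm w i + isBlue (colour i) + arcSlackAt π w i) - γ C
      ≡⟨ cong (_- γ C) (trans (∑-cong (arcTerm+slack π w)) (∑-cyclic-difference (π ∘ vertex))) ⟩
    0ℤ - γ C
      ≡⟨ ℤP.+-identityˡ (- γ C) ⟩
    - γ C
      ∎
    where
    open ≡-Reasoning
    a+s≡a+g+s-g : ∀ a g s → a + s ≡ a + g + s - g
    a+s≡a+g+s-g = solve-∀
    ∑-arcTerm+slack : ∑ℤ (λ i → arcTerm w i + isBlue (colour i) + arcSlackAt π w i)
                    ≡ ∑ℤ (arcTerm w) + ∑ℤ (isBlue ∘ colour) + ∑ℤ (arcSlackAt π w)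
    ∑-arcTerm+slack = trans (∑-distrib-+ (λ i → arcTerm w i + isBlue (colour i)) (arcSlackAt π w))
                            (cong (_+ ∑ℤ (arcSlackAt π w)) (∑-distrib-+ (arcTerm w) (isBlue ∘ colour)))

module _ {n} {ℓ r : Fin n → ℕ} (π w : Fin n → ℤ) where

  cycleIneq-of-potential : (∀ {x y col} → Arc ℓ r x y col → 0ℤ ≤ arcSlack π w col x y) →
                           ∀ C → ∑ℤ (λ z → cycleCoeff C z * w z) ≤ - γ C
  cycleIneq-of-potential slack≥0 C = begin
    ∑ℤ (λ z → cycleCoeff C z * w z)                            ≡⟨ ℤP.+-identityʳ _ ⟨
    ∑ℤ (λ z → cycleCoeff C z * w z) + 0ℤ                       ≤⟨ ℤP.+-monoʳ-≤ (∑ℤ (λ z → cycleCoeff C z * w z)) (∑-nonNeg (slack≥0 ∘ arc)) ⟩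
    ∑ℤ (λ z → cycleCoeff C z * w z) + ∑ℤ (arcSlackAt C π w)    ≡⟨ cycle-slack C π w ⟩
    - γ C                                                      ∎
    where
    open Cycle C
    open ℤP.≤-Reasoning

  cycleEq-of-potential : (∀ {x y col} → Arc ℓ r x y col → arcSlack π w col x y ≡ 0ℤ) →
                         ∀ C → ∑ℤ (λ z → cycleCoeff C z * w z) ≡ - γ C
  cycleEq-of-potential slack≡0 C = begin
    ∑ℤ (λ z → cycleCoeff C z * w z)                            ≡⟨ ℤP.+-identityʳ _ ⟨
    ∑ℤ (λ z → cycleCoeff C z * w z) + 0ℤ                       ≡⟨ cong (_+_ (∑ℤ (λ z → cycleCoeff C z * w z))) ∑slack≡0 ⟨
    ∑ℤ (λ z → cycleCoeff C z * w z) + ∑ℤ (arcSlackAt C π w)    ≡⟨ cycle-slack C π w ⟩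
    - γ C                                                      ∎
    where
    open Cycle C
    open ≡-Reasoning
    ∑slack≡0 : ∑ℤ (arcSlackAt C π w) ≡ 0ℤ
    ∑slack≡0 = trans (∑-cong (slack≡0 ∘ arc)) (∑-zero (suc len))

intervalLength : ∀ {n} (ℓ r : Fin n → ℕ) → Fin n → ℤ
intervalLength ℓ r x = + r x - + ℓ x

module _ {n} {ℓ r : Fin n → ℕ} where

  private
    coverIdentity : ∀ a b → (1ℤ + b) - (a + (b - a) + 1ℤ) ≡ 0ℤ
    coverIdentity = solve-∀
    sharpIdentity : ∀ a b → (a + (b - a)) - b ≡ 0ℤ
    sharpIdentity = solve-∀

  intervalLength-slack≡0 : ∀ {x y col} → Arc ℓ r x y col → arcSlack (+_ ∘ ℓ) (intervalLength ℓ r) col x y ≡ 0ℤ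
  intervalLength-slack≡0 {x}     (coverArc _ ℓy≡1+rx)   rewrite ℓy≡1+rx    = coverIdentity (+ ℓ x) (+ r x)
  intervalLength-slack≡0 {y = y} (sharpArc _ _ _ ry≡ℓx) rewrite sym ry≡ℓx = sharpIdentity (+ ℓ y) (+ r y)
  intervalLength-slack≡0 {x}     (loopArc refl rx≡ℓx)   rewrite sym rx≡ℓx = sharpIdentity (+ r x) (+ r x)

  intervalLength-tight : Tight (cycleSystem ℓ r) (⟦_⟧ ∘ intervalLength ℓ r)
  intervalLength-tight = Tight-⟦⟧ (cycleSystem ℓ r) (cycleEq-of-potential (+_ ∘ ℓ) (intervalLength ℓ r) intervalLength-slack≡0)

-- Decomposing balanced arc multisets into simple cycles

module EdgeLists {n} (ℓ r : Fin n → ℕ) where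

  record Edge : Set where
    constructor edge
    field
      src tgt : Fin n
      col     : Colour
      isArc   : Arc ℓ r src tgt col
  open Edge public

  edgeVec : Edge → Fin n → ℤ
  edgeVec e z = isBlue (col e) * δ (src e) z - isRed (col e) * δ (tgt e) z

  outDeg inDeg : Fin n → List Edge → ℤ
  outDeg v = ∑ˡ (λ e → δ (src e) v)
  inDeg  v = ∑ˡ (λ e → δ (tgt e) v)

  Balanced : List Edge → Set
  Balanced es = ∀ v → outDeg v es ≡ inDeg v es

  Path : Fin n → List Edge → Fin n → Set
  Path u []       w = u ≡ w
  Path u (e ∷ es) w = src e ≡ u × Path (tgt e) es w

  Simple : List Edge → Set
  Simple = AllPairs (λ e e′ → src e ≢ src e′)

  Path-++⁻ : ∀ {u w} xs ys → Path u (xs ++ ys) w → ∃ λ v → Path u xs v × Path v ys w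
  Path-++⁻ {u} []       ys p       = u , refl , p
  Path-++⁻     (e ∷ xs) ys (s , p) = let v , p₁ , p₂ = Path-++⁻ xs ys p in v , (s , p₁) , p₂

  Path-snoc : ∀ {u w} xs e → Path u xs w → src e ≡ w → Path u (xs ++ [ e ]) (tgt e)
  Path-snoc []       e u≡w s = trans s (sym u≡w) , refl
  Path-snoc (x ∷ xs) e (s , p) s′ = s , Path-snoc xs e p s′

  Simple-++⁻ʳ : ∀ xs {ys} → Simple (xs ++ ys) → Simple ys
  Simple-++⁻ʳ []       simple       = simple
  Simple-++⁻ʳ (x ∷ xs) (_ ∷ simple) = Simple-++⁻ʳ xs simple

  Simple-snoc : ∀ {xs} e → Simple xs → All (λ x → src x ≢ src e) xs → Simple (xs ++ [ e ])
  Simple-snoc e simple fresh = AllPairs.++⁺ simple ([] ∷ []) (All.map (_∷ []) fresh)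

  Simple⇒src∘lookup-injective : ∀ es → Simple es → ∀ i j → src (lookup es i) ≡ src (lookup es j) → i ≡ j
  Simple⇒src∘lookup-injective (e ∷ es) (_     ∷ _)      zero    zero    _  = refl
  Simple⇒src∘lookup-injective (e ∷ es) (fresh ∷ _)      zero    (suc j) eq = ⊥-elim (All.lookup fresh (∈-lookup j) eq)
  Simple⇒src∘lookup-injective (e ∷ es) (fresh ∷ _)      (suc i) zero    eq = ⊥-elim (All.lookup fresh (∈-lookup i) (sym eq))
  Simple⇒src∘lookup-injective (e ∷ es) (_     ∷ simple) (suc i) (suc j) eq =
    cong suc (Simple⇒src∘lookup-injective es simple i j eq)

  Path-lastTgt : ∀ {u w} e es → Path u (e ∷ es) w → tgt (lookup (e ∷ es) (fromℕ (length es))) ≡ w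
  Path-lastTgt e []        (_ , t≡w) = t≡w
  Path-lastTgt e (e′ ∷ es) (_ , path) = Path-lastTgt e′ es path

  Path-consecutive : ∀ {u w} e es → Path u (e ∷ es) w → ∀ j → tgt (lookup (e ∷ es) (inject₁ j)) ≡ src (lookup es j)
  Path-consecutive e (e′ ∷ es) (_ , (s , _))    zero    = sym s
  Path-consecutive e (e′ ∷ es) (_ , path)       (suc j) = Path-consecutive e′ es path j

  module _ {u} (e : Edge) (es : List Edge) (closed : Path u (e ∷ es) u) (simple : Simple (e ∷ es)) where
    private
      K = e ∷ es

    tgt≡src∘next : ∀ i → tgt (lookup K i) ≡ src (lookup K (next i))
    tgt≡src∘next i = subst (λ j → tgt (lookup K j) ≡ src (lookup K (next i))) (prev-next i) (tgt∘prev (next i))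
      where
      tgt∘prev : ∀ j → tgt (lookup K (prev j)) ≡ src (lookup K j)
      tgt∘prev zero    = trans (Path-lastTgt e es closed) (sym (proj₁ closed))
      tgt∘prev (suc j) = Path-consecutive e es closed j

    toCycle : Cycle ℓ r
    toCycle = record
      { len      = length es
      ; vertex   = src ∘ lookup K
      ; distinct = Simple⇒src∘lookup-injective K simple _ _
      ; colour   = col ∘ lookup K
      ; arc      = λ i → subst (λ y → Arc ℓ r (src (lookup K i)) y (col (lookup K i))) (tgt≡src∘next i) (isArc (lookup K i))
      }

    cycleCoeff-toCycle : ∀ z → cycleCoeff toCycle z ≡ ∑ˡ (λ e → edgeVec e z) K
    cycleCoeff-toCycle z = begin
      cycleCoeff toCycle z                          ≡⟨ cycleCoeff-as-arcSum toCycle z ⟩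
      ∑ℤ (arcTerm toCycle (λ x → δ x z))            ≡⟨ ∑-cong arcTerm≡edgeVec ⟩
      ∑ℤ (λ i → edgeVec (lookup K i) z)             ≡⟨ ∑ˡ-lookup (λ e → edgeVec e z) K ⟩
      ∑ˡ (λ e → edgeVec e z) K                      ∎
      where
      open ≡-Reasoning
      arcTerm≡edgeVec : ∀ i → arcTerm toCycle (λ x → δ x z) i ≡ edgeVec (lookup K i) z
      arcTerm≡edgeVec i = cong (λ y → isBlue (col (lookup K i)) * δ (src (lookup K i)) z - isRed (col (lookup K i)) * δ y z)
                               (sym (tgt≡src∘next i))

  outDeg-fresh : ∀ {v} xs → All (λ e → src e ≢ v) xs → outDeg v xs ≡ 0ℤ
  outDeg-fresh []       []             = refl
  outDeg-fresh (e ∷ xs) (e≢v ∷ fresh) = trans (cong₂ _+_ (δ-≢ e≢v) (outDeg-fresh xs fresh)) (ℤP.+-identityˡ 0ℤ)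

  inDeg-pathEnd : ∀ {u w} e es → Path u (e ∷ es) w → 1ℤ ≤ inDeg w (e ∷ es)
  inDeg-pathEnd e []        (_ , refl) = ℤP.≤-reflexive (sym (trans (ℤP.+-identityʳ _) (δ-self (tgt e))))
  inDeg-pathEnd {w = w} e (e′ ∷ es) (_ , path) =
    subst (_≤ inDeg w (e ∷ e′ ∷ es)) (ℤP.+-identityˡ 1ℤ) (ℤP.+-mono-≤ (δ-nonNeg (tgt e) w) (inDeg-pathEnd e′ es path))

  Path-balance : ∀ {u w} xs → Path u xs w → ∀ v → outDeg v xs + δ w v ≡ inDeg v xs + δ u v
  Path-balance []       refl       v = refl
  Path-balance {w = w} (e ∷ xs) (refl , path) v = begin
    δ (src e) v + outDeg v xs + δ w v        ≡⟨ ℤP.+-assoc (δ (src e) v) (outDeg v xs) (δ w v) ⟩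
    δ (src e) v + (outDeg v xs + δ w v)      ≡⟨ cong (_+_ (δ (src e) v)) (Path-balance xs path v) ⟩
    δ (src e) v + (inDeg v xs + δ (tgt e) v) ≡⟨ rotate (δ (src e) v) (inDeg v xs) (δ (tgt e) v) ⟩
    δ (tgt e) v + inDeg v xs + δ (src e) v ∎
    where
    open ≡-Reasoning
    rotate : ∀ a b c → a + (b + c) ≡ c + b + a
    rotate = solve-∀

  Balanced-removeCycle : ∀ {M u} K R → Balanced M → M ↭ K ++ R → Path u K u → Balanced R
  Balanced-removeCycle {M} {u} K R balanced M↭K++R closed v = +-cancelˡ (outDeg v K) (outDeg v R) (inDeg v R) (begin
    outDeg v K + outDeg v R  ≡⟨ ∑ˡ-↭-++ (λ e → δ (src e) v) K R M↭K++R ⟨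
    outDeg v M               ≡⟨ balanced v ⟩
    inDeg v M                ≡⟨ ∑ˡ-↭-++ (λ e → δ (tgt e) v) K R M↭K++R ⟩
    inDeg v K + inDeg v R    ≡⟨ cong (_+ inDeg v R) (+-cancelʳ (δ u v) (outDeg v K) (inDeg v K) (Path-balance K closed v)) ⟨
    outDeg v K + inDeg v R   ∎)
    where open ≡-Reasoning

  deadEnd-impossible : ∀ {M u w} e es pool → Balanced M → M ↭ (e ∷ es) ++ pool → Path u (e ∷ es) w →
                       All (λ x → src x ≢ w) ((e ∷ es) ++ pool) → ⊥
  deadEnd-impossible {M} {u} {w} e es pool balanced M↭ path fresh = 1≰0 (begin
    1ℤ                                    ≡⟨ ℤP.+-identityʳ 1ℤ ⟨
    1ℤ + 0ℤ                               ≤⟨ ℤP.+-mono-≤ (inDeg-pathEnd e es path) (∑ˡ-nonNeg pool (λ x → δ-nonNeg (tgt x) w)) ⟩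
    inDeg w (e ∷ es) + inDeg w pool       ≡⟨ ∑ˡ-↭-++ (λ x → δ (tgt x) w) (e ∷ es) pool M↭ ⟨
    inDeg w M                             ≡⟨ balanced w ⟨
    outDeg w M                            ≡⟨ ∑ˡ-↭ (λ x → δ (src x) w) M↭ ⟩
    outDeg w ((e ∷ es) ++ pool)           ≡⟨ outDeg-fresh ((e ∷ es) ++ pool) fresh ⟩
    0ℤ                                    ∎)
    where
    open ℤP.≤-Reasoning
    1≰0 : ¬ (1ℤ ≤ 0ℤ)
    1≰0 (+≤+ ())

  findSource : ∀ v xs → (∃₂ λ pre suf → ∃ λ e → xs ≡ pre ++ e ∷ suf × src e ≡ v) ⊎ All (λ e → src e ≢ v) xs
  findSource v xs with any? (λ e → src e ≟ v) xs
  ... | yes found = let e , e∈xs , src≡v = find found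
                        pre , suf , xs≡ = ∈-∃++ e∈xs
                    in inj₁ (pre , suf , e , xs≡ , src≡v)
  ... | no  none  = inj₂ (¬Any⇒All¬ xs none)

  record SimpleCycleSplit (M : List Edge) : Set where
    field
      start       : Fin n
      first       : Edge
      rest others : List Edge
      closed      : Path start (first ∷ rest) start
      simple      : Simple (first ∷ rest)
      split       : M ↭ (first ∷ rest) ++ others

  closeCycle : ∀ {M u w} xs pool pre b suf → xs ≡ pre ++ b ∷ suf → src b ≡ w →
               Path u xs w → Simple xs → M ↭ xs ++ pool → SimpleCycleSplit M
  closeCycle {w = w} _ pool pre b suf refl src≡w path simple M↭ = record
    { start  = w
    ; first  = b
    ; rest   = suf
    ; others = pre ++ pool
    ; closed = src≡w , proj₂ (proj₂ (proj₂ (Path-++⁻ pre (b ∷ suf) path)))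
    ; simple = Simple-++⁻ʳ pre simple
    ; split  = ↭.↭-trans M↭ (↭.↭-trans (↭.↭-reflexive (ListP.++-assoc pre (b ∷ suf) pool)) (↭P.shifts pre (b ∷ suf)))
    }

  walk : ∀ M → Balanced M → ∀ fuel {u w} e es pool → length pool ℕ.≤ fuel →
         Path u (e ∷ es) w → Simple (e ∷ es) → M ↭ (e ∷ es) ++ pool → SimpleCycleSplit M
  walk M balanced fuel {w = w} e es pool len path simple M↭ with findSource w (e ∷ es)
  ... | inj₁ (pre , suf , b , eq , src≡w) = closeCycle (e ∷ es) pool pre b suf eq src≡w path simple M↭
  ... | inj₂ freshPath with findSource w pool
  ...   | inj₂ freshPool = ⊥-elim (deadEnd-impossible e es pool balanced M↭ path (AllP.++⁺ freshPath freshPool))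
  ...   | inj₁ (pre , suf , b , refl , src≡w) with fuel
  ...     | zero = ⊥-elim (ℕP.<-irrefl refl (ℕP.<-≤-trans (ℕP.≤-<-trans z≤n (ℕP.≤-reflexive (sym (ListP.length-++-sucʳ pre b suf)))) len))
  ...     | suc fuel′ = walk M balanced fuel′ e (es ++ [ b ]) (pre ++ suf) len′
                          (Path-snoc (e ∷ es) b path src≡w) (Simple-snoc b simple fresh) M↭′
    where
    len′ : length (pre ++ suf) ℕ.≤ fuel′
    len′ = ℕP.≤-pred (subst (ℕ._≤ suc fuel′) (ListP.length-++-sucʳ pre b suf) len)
    fresh : All (λ x → src x ≢ src b) (e ∷ es)
    fresh = All.map (λ x≢w x≡b → x≢w (trans x≡b src≡w)) freshPath
    M↭′ : M ↭ ((e ∷ es) ++ [ b ]) ++ (pre ++ suf)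
    M↭′ = ↭.↭-trans M↭ (↭.↭-trans (↭P.++⁺ˡ (e ∷ es) (↭P.shift b pre suf))
                                    (↭.↭-reflexive (sym (ListP.++-assoc (e ∷ es) [ b ] (pre ++ suf)))))

  decompose : ∀ fuel M → length M ℕ.≤ fuel → Balanced M →
              ∃ λ (Cs : List (Cycle ℓ r)) → ∀ z → ∑ˡ (λ C → cycleCoeff C z) Cs ≡ ∑ˡ (λ e → edgeVec e z) M
  decompose _          []      _          _        = [] , λ _ → refl
  decompose (suc fuel) (e ∷ M) (s≤s len) balanced =
    toCycle first rest closed simple ∷ Cs , λ z → begin
      cycleCoeff (toCycle first rest closed simple) z + ∑ˡ (λ C → cycleCoeff C z) Cs
        ≡⟨ cong₂ _+_ (cycleCoeff-toCycle first rest closed simple z) (sums z) ⟩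
      ∑ˡ (λ e → edgeVec e z) (first ∷ rest) + ∑ˡ (λ e → edgeVec e z) others
        ≡⟨ ∑ˡ-↭-++ (λ e → edgeVec e z) (first ∷ rest) others split ⟨
      ∑ˡ (λ e → edgeVec e z) (e ∷ M)
        ∎
    where
    open ≡-Reasoning
    open SimpleCycleSplit (walk (e ∷ M) balanced (length M) e [] M ℕP.≤-refl (refl , refl) ([] ∷ []) ↭.↭-refl)
    lenOthers : length others ℕ.≤ fuel
    lenOthers = ℕP.≤-pred (ℕP.<-≤-trans (↭-++-length-< first rest others split) (s≤s len))
    recursion = decompose fuel others lenOthers (Balanced-removeCycle (first ∷ rest) others balanced split closed)
    Cs = proj₁ recursion
    sums = proj₂ recursion

  balanced⇒cycleSum : ∀ M → Balanced M → ∃ λ (Cs : List (Cycle ℓ r)) → ∀ z → ∑ˡ (λ C → cycleCoeff C z) Cs ≡ ∑ˡ (λ e → edgeVec e z) M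
  balanced⇒cycleSum M = decompose (length M) M ℕP.≤-refl

-- Canonical representations

merge : ℕ → ℕ → ℕ
merge zero    zero    = 0
merge zero    (suc p) = p
merge (suc j) zero    = 0
merge (suc j) (suc p) = suc (merge j p)

unmerge : ℕ → ℕ → ℕ
unmerge zero    zero    = 0
unmerge zero    (suc k) = suc (suc k)
unmerge (suc j) zero    = 0
unmerge (suc j) (suc k) = suc (unmerge j k)

merge-mono-≤ : ∀ j {p q} → p ℕ.≤ q → merge j p ℕ.≤ merge j q
merge-mono-≤ zero    {zero}  _         = z≤n
merge-mono-≤ zero    {suc p} (s≤s p≤q) = p≤q
merge-mono-≤ (suc j) {zero}  _         = z≤n
merge-mono-≤ (suc j) {suc p} (s≤s p≤q) = s≤s (merge-mono-≤ j p≤q)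

merge-mono-< : ∀ j {p q} → p ℕ.< q → ¬ (p ≡ j × q ≡ suc j) → merge j p ℕ.< merge j q
merge-mono-< zero    {zero}  {suc zero}    _         notMerged = ⊥-elim (notMerged (refl , refl))
merge-mono-< zero    {zero}  {suc (suc q)} _         _         = s≤s z≤n
merge-mono-< zero    {suc p} {suc q}       (s≤s p<q) _         = p<q
merge-mono-< (suc j) {zero}  {suc q}       _         _         = s≤s z≤n
merge-mono-< (suc j) {suc p} {suc q}       (s≤s p<q) notMerged =
  s≤s (merge-mono-< j p<q (λ (p≡j , q≡1+j) → notMerged (cong suc p≡j , cong suc q≡1+j)))

merge-unmerge : ∀ j k → merge j (unmerge j k) ≡ k
merge-unmerge zero    zero    = refl
merge-unmerge zero    (suc k) = refl
merge-unmerge (suc j) zero    = refl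
merge-unmerge (suc j) (suc k) = cong suc (merge-unmerge j k)

unmerge-≤ : ∀ j k → unmerge j k ℕ.≤ suc k
unmerge-≤ zero    zero    = z≤n
unmerge-≤ zero    (suc k) = ℕP.≤-refl
unmerge-≤ (suc j) zero    = z≤n
unmerge-≤ (suc j) (suc k) = s≤s (unmerge-≤ j k)

merge-< : ∀ j {p m} → p ℕ.< suc m → j ℕ.< m → merge j p ℕ.< m
merge-< zero    {zero}  _         j<m       = j<m
merge-< zero    {suc p} (s≤s p<m) _         = p<m
merge-< (suc j) {zero}  _         j<m       = ℕP.<-trans (s≤s z≤n) j<m
merge-< (suc j) {suc p} {suc m} (s≤s p<m) (s≤s j<m) = s≤s (merge-< j p<m j<m)

module _ {n} {ℓ r : Fin n → ℕ} (canonical : IsCanonical ℓ r) where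
  private
    isRep     = proj₁ canonical
    m         = proj₁ (proj₂ canonical)
    endpoints = proj₁ (proj₂ (proj₂ canonical))
    minimal   = proj₂ (proj₂ (proj₂ canonical))

  -- Otherwise merging the endpoints j and j + 1 represents the same order with fewer endpoints.
  canonical⇒adjacentEndpoints : ∀ j → suc j ℕ.< m → ¬ (∀ x y → r x ≡ j → ℓ y ≡ suc j → ⊥)
  canonical⇒adjacentEndpoints j 1+j<m noAdjacent = ℕP.<-irrefl refl (ℕP.<-≤-trans m′<m (minimal ℓ′ r′ m′ isRep′ samePrec endpoints′))
    where
    ℓ′ r′ : Fin n → ℕ
    ℓ′ = merge j ∘ ℓ
    r′ = merge j ∘ r
    m′ = ℕ.pred m
    m≡1+m′ : suc m′ ≡ m
    m≡1+m′ = ℕP.suc-pred m {{ℕ.>-nonZero (ℕP.<-trans (s≤s z≤n) 1+j<m)}}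
    m′<m : m′ ℕ.< m
    m′<m = subst (m′ ℕ.<_) m≡1+m′ (ℕP.n<1+n m′)
    j<m′ : j ℕ.< m′
    j<m′ = ℕP.<-≤-trans (ℕP.n<1+n j) (ℕP.<⇒≤pred 1+j<m)
    isRep′ : IsRep ℓ′ r′
    isRep′ x = merge-mono-≤ j (isRep x)
    samePrec : ∀ x y → Prec ℓ r x y ⇔ Prec ℓ′ r′ x y
    samePrec x y = mk⇔ (λ r<ℓ → merge-mono-< j r<ℓ (λ (rx≡j , ℓy≡1+j) → noAdjacent x y rx≡j ℓy≡1+j))
                       (λ r′<ℓ′ → ℕP.≰⇒> (λ ℓ≤r → ℕP.<⇒≱ r′<ℓ′ (merge-mono-≤ j ℓ≤r)))
    below : ∀ {p} → p ℕ.< m → merge j p ℕ.< m′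
    below p<m = merge-< j (subst (_ ℕ.<_) (sym m≡1+m′) p<m) j<m′
    hit : ∀ {k} → (∃ λ x → ℓ x ≡ unmerge j k ⊎ r x ≡ unmerge j k) → ∃ λ x → ℓ′ x ≡ k ⊎ r′ x ≡ k
    hit {k} (x , inj₁ ℓx≡) = x , inj₁ (trans (cong (merge j) ℓx≡) (merge-unmerge j k))
    hit {k} (x , inj₂ rx≡) = x , inj₂ (trans (cong (merge j) rx≡) (merge-unmerge j k))
    endpoints′ : EndpointsExactly ℓ′ r′ m′
    endpoints′ = (λ x → below (proj₁ (proj₁ endpoints x)) , below (proj₂ (proj₁ endpoints x)))
               , λ k k<m′ → hit (proj₂ endpoints (unmerge j k)
                                  (ℕP.≤-trans (s≤s (unmerge-≤ j k)) (subst (suc (suc k) ℕ.≤_) m≡1+m′ (s≤s k<m′))))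

  canonical⇒leftEndpoint : ∀ k → k ℕ.< m → ∃ λ x → ℓ x ≡ k
  canonical⇒leftEndpoint k k<m with anyFin? (λ x → ℓ x ℕP.≟ k)
  ... | yes found = found
  ... | no  none  with k
  ...   | zero  = ⊥-elim (endpointAt0 (proj₂ endpoints 0 k<m))
    where
    endpointAt0 : ¬ (∃ λ x → ℓ x ≡ 0 ⊎ r x ≡ 0)
    endpointAt0 (x , inj₁ ℓx≡0) = none (x , ℓx≡0)
    endpointAt0 (x , inj₂ rx≡0) = none (x , ℕP.n≤0⇒n≡0 (subst (ℓ x ℕ.≤_) rx≡0 (isRep x)))
  ...   | suc j = ⊥-elim (canonical⇒adjacentEndpoints j k<m (λ _ y _ ℓy≡k → none (y , ℓy≡k)))

  canonical⇒rightEndpoint : ∀ k → k ℕ.< m → ∃ λ x → r x ≡ k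
  canonical⇒rightEndpoint k k<m with anyFin? (λ x → r x ℕP.≟ k)
  ... | yes found = found
  ... | no  none  with suc k ℕP.<? m
  ...   | yes 1+k<m = ⊥-elim (canonical⇒adjacentEndpoints k 1+k<m (λ x _ rx≡k _ → none (x , rx≡k)))
  ...   | no  1+k≮m = ⊥-elim (endpointAtLast (proj₂ endpoints k k<m))
    where
    m≡1+k : m ≡ suc k
    m≡1+k = ℕP.≤-antisym (ℕP.≮⇒≥ 1+k≮m) k<m
    endpointAtLast : ¬ (∃ λ x → ℓ x ≡ k ⊎ r x ≡ k)
    endpointAtLast (x , inj₂ rx≡k) = none (x , rx≡k)
    endpointAtLast (x , inj₁ ℓx≡k) = none (x , ℕP.≤-antisym (ℕP.≤-pred (subst (r x ℕ.<_) m≡1+k (proj₂ (proj₁ endpoints x))))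
                                                           (subst (ℕ._≤ r x) ℓx≡k (isRep x)))

-- Positions on the doubled line

double : ℕ → ℕ
double zero    = zero
double (suc a) = suc (suc (double a))

data Parity : ℕ → Set where
  even : ∀ k → Parity (double k)
  odd  : ∀ k → Parity (suc (double k))

parity : ∀ p → Parity p
parity zero = even 0
parity (suc p) with parity p
... | even k = odd k
... | odd  k = even (suc k)

double-mono-≤ : ∀ {a b} → a ℕ.≤ b → double a ℕ.≤ double b
double-mono-≤ z≤n       = z≤n
double-mono-≤ (s≤s a≤b) = s≤s (s≤s (double-mono-≤ a≤b))

double-injective : ∀ {a b} → double a ≡ double b → a ≡ b
double-injective {zero}  {zero}  _  = refl
double-injective {suc a} {suc b} eq = cong suc (double-injective (ℕP.suc-injective (ℕP.suc-injective eq)))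

double≢1+double : ∀ a b → double a ≢ suc (double b)
double≢1+double (suc a) zero    ()
double≢1+double (suc a) (suc b) eq = double≢1+double a b (ℕP.suc-injective (ℕP.suc-injective eq))

double-<-cancel : ∀ {a b} → double a ℕ.< double b → a ℕ.< b
double-<-cancel {zero}  {suc b} _                 = s≤s z≤n
double-<-cancel {suc a} {suc b} (s≤s (s≤s 2a<2b)) = s≤s (double-<-cancel 2a<2b)

1+double-<-cancel : ∀ {a b} → suc (double a) ℕ.< double b → a ℕ.< b
1+double-<-cancel {zero}  {suc b} _                 = s≤s z≤n
1+double-<-cancel {suc a} {suc b} (s≤s (s≤s 2a<2b)) = s≤s (1+double-<-cancel 2a<2b)

χ< : ℕ → ℕ → ℤ
χ< _       zero    = 0ℤ
χ< zero    (suc b) = 1ℤ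
χ< (suc a) (suc b) = χ< a b

χ≡ : ℕ → ℕ → ℤ
χ≡ zero    zero    = 1ℤ
χ≡ zero    (suc _) = 0ℤ
χ≡ (suc _) zero    = 0ℤ
χ≡ (suc a) (suc b) = χ≡ a b

χodd : ℕ → ℤ
χodd zero          = 0ℤ
χodd (suc zero)    = 1ℤ
χodd (suc (suc a)) = χodd a

χ<-nonNeg : ∀ a b → 0ℤ ≤ χ< a b
χ<-nonNeg _       zero    = ℤP.≤-refl
χ<-nonNeg zero    (suc b) = +≤+ z≤n
χ<-nonNeg (suc a) (suc b) = χ<-nonNeg a b

χ<-≤1 : ∀ a b → χ< a b ≤ 1ℤ
χ<-≤1 _       zero    = +≤+ z≤n
χ<-≤1 zero    (suc b) = ℤP.≤-refl
χ<-≤1 (suc a) (suc b) = χ<-≤1 a b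

χ<-monoʳ-≤ : ∀ a {b c} → b ℕ.≤ c → χ< a b ≤ χ< a c
χ<-monoʳ-≤ a       {zero}  {c}     _         = χ<-nonNeg a c
χ<-monoʳ-≤ zero    {suc b} {suc c} _         = ℤP.≤-refl
χ<-monoʳ-≤ (suc a) {suc b} {suc c} (s≤s b≤c) = χ<-monoʳ-≤ a b≤c

χ<-complement : ∀ a b → χ< a b ≡ 1ℤ - χ< b (suc a)
χ<-complement a       zero    = refl
χ<-complement zero    (suc b) = refl
χ<-complement (suc a) (suc b) = χ<-complement a b

χ<-suc : ∀ a b → χ< a (suc b) ≡ χ< a b + χ≡ a b
χ<-suc zero    zero    = refl
χ<-suc zero    (suc b) = refl
χ<-suc (suc a) zero    = refl
χ<-suc (suc a) (suc b) = χ<-suc a b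

χ<-true : ∀ {a b} → a ℕ.< b → χ< a b ≡ 1ℤ
χ<-true {zero}  {suc b} _         = refl
χ<-true {suc a} {suc b} (s≤s a<b) = χ<-true a<b

χ<≡1⇒< : ∀ {a b} → χ< a b ≡ 1ℤ → a ℕ.< b
χ<≡1⇒< {zero}  {suc b} _  = s≤s z≤n
χ<≡1⇒< {suc a} {suc b} eq = s≤s (χ<≡1⇒< eq)

χ<≡0⇒≥ : ∀ {a b} → χ< a b ≡ 0ℤ → b ℕ.≤ a
χ<≡0⇒≥ {a}     {zero}  _  = z≤n
χ<≡0⇒≥ {suc a} {suc b} eq = s≤s (χ<≡0⇒≥ eq)

χ≡-refl : ∀ a → χ≡ a a ≡ 1ℤ
χ≡-refl zero    = refl
χ≡-refl (suc a) = χ≡-refl a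

χ≡-≢ : ∀ {a b} → a ≢ b → χ≡ a b ≡ 0ℤ
χ≡-≢ {zero}  {zero}  a≢b = ⊥-elim (a≢b refl)
χ≡-≢ {zero}  {suc b} _   = refl
χ≡-≢ {suc a} {zero}  _   = refl
χ≡-≢ {suc a} {suc b} a≢b = χ≡-≢ (a≢b ∘ cong suc)

χ≡-sym : ∀ a b → χ≡ a b ≡ χ≡ b a
χ≡-sym zero    zero    = refl
χ≡-sym zero    (suc b) = refl
χ≡-sym (suc a) zero    = refl
χ≡-sym (suc a) (suc b) = χ≡-sym a b

*-χ≡-transport : ∀ (g : ℕ → ℤ) a b → g a * χ≡ a b ≡ χ≡ a b * g b
*-χ≡-transport g a b with a ℕP.≟ b
... | yes refl = ℤP.*-comm (g a) (χ≡ a a)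
... | no  a≢b  = trans (cong (g a *_) (χ≡-≢ a≢b)) (trans (ℤP.*-zeroʳ (g a)) (sym (trans (cong (_* g b) (χ≡-≢ a≢b)) (ℤP.*-zeroˡ (g b)))))

χodd-double : ∀ a → χodd (double a) ≡ 0ℤ
χodd-double zero    = refl
χodd-double (suc a) = χodd-double a

χodd-1+double : ∀ a → χodd (suc (double a)) ≡ 1ℤ
χodd-1+double zero    = refl
χodd-1+double (suc a) = χodd-1+double a

∑< : ℕ → (ℕ → ℤ) → ℤ
∑< zero    f = 0ℤ
∑< (suc B) f = ∑< B f + f B

∑<-cong : ∀ B {f g : ℕ → ℤ} → (∀ j → f j ≡ g j) → ∑< B f ≡ ∑< B g
∑<-cong zero    eq = refl
∑<-cong (suc B) eq = cong₂ _+_ (∑<-cong B eq) (eq B)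

∑<-zero : ∀ B → ∑< B (λ _ → 0ℤ) ≡ 0ℤ
∑<-zero zero    = refl
∑<-zero (suc B) = trans (ℤP.+-identityʳ _) (∑<-zero B)

∑<-distrib-+ : ∀ B (f g : ℕ → ℤ) → ∑< B (λ j → f j + g j) ≡ ∑< B f + ∑< B g
∑<-distrib-+ zero    f g = refl
∑<-distrib-+ (suc B) f g =
  trans (cong (_+ (f B + g B)) (∑<-distrib-+ B f g)) (+-interchange (∑< B f) (∑< B g) (f B) (g B))

*-distribʳ-∑< : ∀ B (f : ℕ → ℤ) a → ∑< B (λ j → f j * a) ≡ ∑< B f * a
*-distribʳ-∑< zero    f a = sym (ℤP.*-zeroˡ a)
*-distribʳ-∑< (suc B) f a =
  trans (cong (_+ f B * a) (*-distribʳ-∑< B f a)) (sym (ℤP.*-distribʳ-+ a (∑< B f) (f B)))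

∑<-χ≡ : ∀ a B → ∑< B (χ≡ a) ≡ χ< a B
∑<-χ≡ a zero    = refl
∑<-χ≡ a (suc B) = trans (cong (_+ χ≡ a B) (∑<-χ≡ a B)) (sym (χ<-suc a B))

∑<-χ≡-suc : ∀ a B → ∑< B (χ≡ a ∘ suc) ≡ χ< a (suc B) - χ≡ a 0
∑<-χ≡-suc a zero    = sym (trans (cong (_- χ≡ a 0) (χ<-suc a 0)) (x+y-y≡x (χ< a 0) (χ≡ a 0)))
  where
  x+y-y≡x : ∀ x y → x + y - y ≡ x
  x+y-y≡x = solve-∀
∑<-χ≡-suc a (suc B) = begin
  ∑< B (χ≡ a ∘ suc) + χ≡ a (suc B)                   ≡⟨ cong (_+ χ≡ a (suc B)) (∑<-χ≡-suc a B) ⟩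
  χ< a (suc B) - χ≡ a 0 + χ≡ a (suc B)               ≡⟨ swapLast (χ< a (suc B)) (χ≡ a 0) (χ≡ a (suc B)) ⟩
  χ< a (suc B) + χ≡ a (suc B) - χ≡ a 0               ≡⟨ cong (_- χ≡ a 0) (χ<-suc a (suc B)) ⟨
  χ< a (suc (suc B)) - χ≡ a 0                        ∎
  where
  open ≡-Reasoning
  swapLast : ∀ x y z → x - y + z ≡ x + z - y
  swapLast = solve-∀

∑<-pick : ∀ B j (g : ℕ → ℤ) → ∑< B (λ P → g P * χ≡ P j) ≡ χ< j B * g j
∑<-pick zero    j g = sym (ℤP.*-zeroˡ (g j))
∑<-pick (suc B) j g = begin
  ∑< B (λ P → g P * χ≡ P j) + g B * χ≡ B j    ≡⟨ cong₂ _+_ (∑<-pick B j g) (*-χ≡-transport g B j) ⟩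
  χ< j B * g j + χ≡ B j * g j                 ≡⟨ ℤP.*-distribʳ-+ (g j) (χ< j B) (χ≡ B j) ⟨
  (χ< j B + χ≡ B j) * g j                     ≡⟨ cong (λ t → (χ< j B + t) * g j) (χ≡-sym B j) ⟩
  (χ< j B + χ≡ j B) * g j                     ≡⟨ cong (_* g j) (χ<-suc j B) ⟨
  χ< j (suc B) * g j                          ∎
  where open ≡-Reasoning

∑<-∑ˡ : ∀ {A : Set} B (h : ℕ → A → ℤ) xs → ∑< B (λ j → ∑ˡ (h j) xs) ≡ ∑ˡ (λ x → ∑< B (λ j → h j x)) xs
∑<-∑ˡ B h []       = ∑<-zero B
∑<-∑ˡ B h (x ∷ xs) = trans (∑<-distrib-+ B (λ j → h j x) (λ j → ∑ˡ (h j) xs)) (cong (_+_ (∑< B (λ j → h j x))) (∑<-∑ˡ B h xs))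

module _ {A : Set} where

  replicateBelow : ∀ B → (ℕ → ℕ) → (∀ P → P ℕ.< B → A) → List A
  replicateBelow zero    μ e = []
  replicateBelow (suc B) μ e = replicateBelow B μ (λ P P<B → e P (ℕP.m<n⇒m<1+n P<B)) ++ replicate (μ B) (e B (ℕP.n<1+n B))

  ∑ˡ-replicateBelow : ∀ (f : A → ℤ) (F : ℕ → ℤ) B μ e → (∀ P P<B → f (e P P<B) ≡ F P) →
                      ∑ˡ f (replicateBelow B μ e) ≡ ∑< B (λ P → + μ P * F P)
  ∑ˡ-replicateBelow f F zero    μ e f≡F = refl
  ∑ˡ-replicateBelow f F (suc B) μ e f≡F = trans (∑ˡ-++ f (replicateBelow B μ _) _)
    (cong₂ _+_ (∑ˡ-replicateBelow f F B μ _ (λ P P<B → f≡F P _))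
               (trans (∑ˡ-replicate f (μ B) _) (cong (+ μ B *_) (f≡F B _))))

  All-replicateBelow : ∀ {P : A → Set} B μ e → (∀ p p<B → μ p ≡ 0 ⊎ P (e p p<B)) → All P (replicateBelow B μ e)
  All-replicateBelow zero    μ e _      = []
  All-replicateBelow (suc B) μ e zeroOrP =
    AllP.++⁺ (All-replicateBelow B μ _ (λ p p<B → zeroOrP p _)) (All-replicate (μ B) _ (zeroOrP B _))

colourAt : ℕ → Colour
colourAt zero          = red
colourAt (suc zero)    = blue
colourAt (suc (suc j)) = colourAt j

isBlue-colourAt : ∀ j → isBlue (colourAt j) ≡ χodd j
isBlue-colourAt zero          = refl
isBlue-colourAt (suc zero)    = refl
isBlue-colourAt (suc (suc j)) = isBlue-colourAt j

isRed-colourAt : ∀ j → isRed (colourAt j) ≡ χodd (suc j)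
isRed-colourAt zero          = refl
isRed-colourAt (suc zero)    = refl
isRed-colourAt (suc (suc j)) = isRed-colourAt j

colourAt-double : ∀ a → colourAt (double a) ≡ red
colourAt-double zero    = refl
colourAt-double (suc a) = colourAt-double a

colourAt-1+double : ∀ a → colourAt (suc (double a)) ≡ blue
colourAt-1+double zero    = refl
colourAt-1+double (suc a) = colourAt-1+double a

-- Unboundedness across a negative cut

module Cut {n} (ℓ r : Fin n → ℕ) (c : Fin n → ℤ) where

  -- Positions where a cycle's visit to x departs and arrives: forward for c x ≥ 0, backward otherwise.
  exitAt entryAt : ℤ → ℕ → ℕ → ℕ
  exitAt  (+ _)    a b = suc (double b)
  exitAt  -[1+ _ ] a b = double a
  entryAt (+ _)    a b = double a
  entryAt -[1+ _ ] a b = suc (double b)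

  exit entry : Fin n → ℕ
  exit  x = exitAt  (c x) (ℓ x) (r x)
  entry x = entryAt (c x) (ℓ x) (r x)

  μ : Fin n → ℕ
  μ x = ℤ.∣ c x ∣

  cut : ℕ → ℤ
  cut P = ∑ℤ (λ x → + μ x * (χ< (exit x) P - χ< (entry x) (suc P)))

  -- An endpoint at position P itself moves iff c x > 0 (right endpoint) or c x ≤ 0 (left endpoint);
  -- this makes the objective change exactly −t · cut P.
  tieL tieR : ℤ → ℕ
  tieL (+ suc _) = 0
  tieL _         = 1
  tieR (+ suc _) = 1
  tieR _         = 0

  module Shift (P t : ℕ) where

    movesL movesR : Fin n → ℤ
    movesL x = χ< P (tieL (c x) ℕ.+ double (ℓ x))
    movesR x = χ< P (tieR (c x) ℕ.+ suc (double (r x)))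

    shiftedL shiftedR width : Fin n → ℤ
    shiftedL x = + ℓ x + + t * movesL x
    shiftedR x = + r x + + t * movesR x
    width    x = shiftedR x - shiftedL x

    movesR≤movesL : ∀ x y → ℓ y ≡ suc (r x) → movesR x ≤ movesL y
    movesR≤movesL x y ℓy≡1+rx = χ<-monoʳ-≤ P (begin
      tieR (c x) ℕ.+ suc (double (r x))  ≤⟨ ℕP.+-monoˡ-≤ _ (tieR≤1 (c x)) ⟩
      suc (suc (double (r x)))           ≡⟨ cong double ℓy≡1+rx ⟨
      double (ℓ y)                       ≤⟨ ℕP.m≤n+m _ (tieL (c y)) ⟩
      tieL (c y) ℕ.+ double (ℓ y)        ∎)
      where
      open ℕP.≤-Reasoning
      tieR≤1 : ∀ k → tieR k ℕ.≤ 1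
      tieR≤1 (+ zero)  = z≤n
      tieR≤1 (+ suc _) = ℕP.≤-refl
      tieR≤1 -[1+ _ ]  = z≤n

    movesL≤movesR : ∀ x y → r y ≡ ℓ x → movesL x ≤ movesR y
    movesL≤movesR x y ry≡ℓx = χ<-monoʳ-≤ P (begin
      tieL (c x) ℕ.+ double (ℓ x)        ≤⟨ ℕP.+-monoˡ-≤ _ (tieL≤1 (c x)) ⟩
      suc (double (ℓ x))                 ≡⟨ cong (suc ∘ double) ry≡ℓx ⟨
      suc (double (r y))                 ≤⟨ ℕP.m≤n+m _ (tieR (c y)) ⟩
      tieR (c y) ℕ.+ suc (double (r y))  ∎)
      where
      open ℕP.≤-Reasoning
      tieL≤1 : ∀ k → tieL k ℕ.≤ 1
      tieL≤1 (+ zero)  = ℕP.≤-refl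
      tieL≤1 (+ suc _) = z≤n
      tieL≤1 -[1+ _ ]  = ℕP.≤-refl

    sharpSlack-nonNeg : ∀ x y → r y ≡ ℓ x → 0ℤ ≤ arcSlack shiftedL width red x y
    sharpSlack-nonNeg x y ry≡ℓx =
      subst (0ℤ ≤_) (sym (sharpSlack (shiftedL y) (shiftedR y) (shiftedL x))) (ℤP.i≤j⇒0≤j-i (begin
        shiftedL x                      ≡⟨ cong (λ k → + k + + t * movesL x) ry≡ℓx ⟨
        + r y + + t * movesL x          ≤⟨ ℤP.+-monoʳ-≤ (+ r y) (ℤP.*-monoˡ-≤-nonNeg (+ t) (movesL≤movesR x y ry≡ℓx)) ⟩
        shiftedR y                      ∎))
      where
      open ℤP.≤-Reasoning
      sharpSlack : ∀ a b c → a + (b - a) - c ≡ b - c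
      sharpSlack = solve-∀

    shift-slack-nonNeg : ∀ {x y col} → Arc ℓ r x y col → 0ℤ ≤ arcSlack shiftedL width col x y
    shift-slack-nonNeg {x} {y} (coverArc _ ℓy≡1+rx) =
      subst (0ℤ ≤_) (sym (coverSlack (shiftedL y) (shiftedL x) (shiftedR x))) (ℤP.i≤j⇒0≤j-i (begin
        shiftedR x + 1ℤ                 ≡⟨ shuffle (+ r x) (+ t * movesR x) ⟩
        + suc (r x) + + t * movesR x    ≤⟨ ℤP.+-monoʳ-≤ (+ suc (r x)) (ℤP.*-monoˡ-≤-nonNeg (+ t) (movesR≤movesL x y ℓy≡1+rx)) ⟩
        + suc (r x) + + t * movesL y    ≡⟨ cong (λ k → + k + + t * movesL y) ℓy≡1+rx ⟨
        shiftedL y                      ∎))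
      where
      open ℤP.≤-Reasoning
      coverSlack : ∀ a b c → a - (b + (c - b) + 1ℤ) ≡ a - (c + 1ℤ)
      coverSlack = solve-∀
      shuffle : ∀ a b → a + b + 1ℤ ≡ 1ℤ + a + b
      shuffle = solve-∀
    shift-slack-nonNeg {x} {y} (sharpArc _ _ _ ry≡ℓx) = sharpSlack-nonNeg x y ry≡ℓx
    shift-slack-nonNeg {x}     (loopArc refl rx≡ℓx)   = sharpSlack-nonNeg x x rx≡ℓx

    objectiveTerm : ∀ x → c x * (movesR x - movesL x) ≡ - (+ μ x * (χ< (exit x) P - χ< (entry x) (suc P)))
    objectiveTerm x with c x
    ... | + zero   = trans (ℤP.*-zeroˡ (movesR x - movesL x))
                           (cong -_ (sym (ℤP.*-zeroˡ (χ< (exit x) P - χ< (entry x) (suc P)))))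
    ... | + suc k  = trans (cong (λ d → + suc k * d) (cong₂ _-_ (χ<-complement P (suc (suc (double (r x)))))
                                                               (χ<-complement P (double (ℓ x)))))
                           (positive (+ suc k) (χ< (suc (double (r x))) P) (χ< (double (ℓ x)) (suc P)))
      where
      positive : ∀ u a b → u * ((1ℤ - a) - (1ℤ - b)) ≡ - (u * (a - b))
      positive = solve-∀
    ... | -[1+ k ] = trans (cong (λ d → -[1+ k ] * d) (cong₂ _-_ (χ<-complement P (suc (double (r x))))
                                                                (χ<-complement P (suc (double (ℓ x))))))
                           (negative (+ suc k) (χ< (double (ℓ x)) P) (χ< (suc (double (r x))) (suc P)))
      where
      negative : ∀ u a b → - u * ((1ℤ - b) - (1ℤ - a)) ≡ - (u * (a - b))
      negative = solve-∀

    ∑-objective : ∑ℤ (λ x → c x * width x) ≡ ∑ℤ (λ x → c x * intervalLength ℓ r x) + + t * - cut P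
    ∑-objective = begin
      ∑ℤ (λ x → c x * width x)
        ≡⟨ ∑-cong (λ x → split (c x) (+ r x) (+ ℓ x) (+ t) (movesR x) (movesL x)) ⟩
      ∑ℤ (λ x → c x * intervalLength ℓ r x + + t * (c x * (movesR x - movesL x)))
        ≡⟨ ∑-distrib-+ (λ x → c x * intervalLength ℓ r x) (λ x → + t * (c x * (movesR x - movesL x))) ⟩
      ∑ℤ (λ x → c x * intervalLength ℓ r x) + ∑ℤ (λ x → + t * (c x * (movesR x - movesL x)))
        ≡⟨ cong (_+_ K) (*-distribˡ-∑ (+ t) (λ x → c x * (movesR x - movesL x))) ⟩
      ∑ℤ (λ x → c x * intervalLength ℓ r x) + + t * ∑ℤ (λ x → c x * (movesR x - movesL x))
        ≡⟨ cong (λ d → K + + t * d) (trans (∑-cong objectiveTerm) (∑-distrib-neg (λ x → + μ x * (χ< (exit x) P - χ< (entry x) (suc P))))) ⟩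
      ∑ℤ (λ x → c x * intervalLength ℓ r x) + + t * - cut P
        ∎
      where
      open ≡-Reasoning
      K = ∑ℤ (λ x → c x * intervalLength ℓ r x)
      split : ∀ k a b u d e → k * ((a + u * d) - (b + u * e)) ≡ k * (a - b) + u * (k * (d - e))
      split = solve-∀

  cut<0⇒unbounded : ∀ P → cut P < 0ℤ → ¬ MaxFinite (cycleSystem ℓ r) c
  cut<0⇒unbounded P cut<0 (_ , M , bounded) = ℤP.<-irrefl refl (ℤP.<-≤-trans large small)
    where
    K = ∑ℤ (λ x → c x * intervalLength ℓ r x)
    U = + ℤ.∣ ℚ.↥ M ∣
    t = suc ℤ.∣ U - K ∣
    open Shift P t

    small : K + + t * - cut P ≤ U
    small = ⟦⟧-cancel-≤ (ℚP.≤-trans (subst (ℚ._≤ M) objective (bounded (⟦_⟧ ∘ width) feasible)) (≤⟦∣↥∣⟧ M))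
      where
      feasible = Feasible-⟦⟧ (cycleSystem ℓ r) (cycleIneq-of-potential shiftedL width shift-slack-nonNeg)
      objective = trans (∑ℚ-⟦⟧-* c width) (cong ⟦_⟧ ∑-objective)

    large : U < K + + t * - cut P
    large = begin-strict
      U                    ≡⟨ k+[u-k]≡u K U ⟨
      K + (U - K)          ≤⟨ ℤP.+-monoʳ-≤ K (i≤+∣i∣ (U - K)) ⟩
      K + + ℤ.∣ U - K ∣    <⟨ ℤP.+-monoʳ-< K (ℤ.+<+ (ℕP.n<1+n _)) ⟩
      K + + t              ≡⟨ cong (_+_ K) (ℤP.*-identityʳ (+ t)) ⟨
      K + + t * 1ℤ         ≤⟨ ℤP.+-monoʳ-≤ K (ℤP.*-monoˡ-≤-nonNeg (+ t) (ℤP.i<j⇒suc[i]≤j (ℤP.neg-mono-< cut<0))) ⟩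
      K + + t * - cut P    ∎
      where
      open ℤP.≤-Reasoning
      k+[u-k]≡u : ∀ k u → k + (u - k) ≡ u
      k+[u-k]≡u = solve-∀

-- Stations and the arcs between them

module Stations {n} (ℓ r : Fin n → ℕ) (isRep : IsRep ℓ r) where
  open EdgeLists ℓ r

  EndpointOf : Fin n → ℕ → Set
  EndpointOf v P = P ≡ double (ℓ v) ⊎ P ≡ suc (double (r v))

  record Station : Set where
    constructor station
    field
      node            : Fin n
      departs arrives : ℕ
      departsAtEnd    : EndpointOf node departs
      arrivesAtEnd    : EndpointOf node arrives
  open Station public

  consecutiveEndpoints : ∀ {v v′ j} → EndpointOf v j → EndpointOf v′ (suc j) →
                         (j ≡ suc (double (r v)) × ℓ v′ ≡ suc (r v)) ⊎ (j ≡ double (ℓ v) × r v′ ≡ ℓ v)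
  consecutiveEndpoints {v} {v′} (inj₁ refl) (inj₁ 1+2ℓ≡2ℓ′)   = ⊥-elim (double≢1+double (ℓ v′) (ℓ v) (sym 1+2ℓ≡2ℓ′))
  consecutiveEndpoints {v} {v′} (inj₂ refl) (inj₂ 2+2r≡1+2r′) = ⊥-elim (double≢1+double (r v′) (r v) (sym (ℕP.suc-injective 2+2r≡1+2r′)))
  consecutiveEndpoints          (inj₂ refl) (inj₁ 2+2r≡2ℓ′)   = inj₁ (refl , double-injective (sym 2+2r≡2ℓ′))
  consecutiveEndpoints          (inj₁ refl) (inj₂ 1+2ℓ≡1+2r′) = inj₂ (refl , double-injective (ℕP.suc-injective (sym 1+2ℓ≡1+2r′)))

  sharpOrLoopArc : ∀ {x y} → r y ≡ ℓ x → Arc ℓ r x y red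
  sharpOrLoopArc {x} {y} ry≡ℓx with x ≟ y
  ... | yes x≡y = loopArc x≡y (trans (cong r x≡y) ry≡ℓx)
  ... | no  x≢y = sharpArc x≢y
                    (λ rx<ℓy → ℕP.<-irrefl refl (ℕP.<-≤-trans rx<ℓy (ℕP.≤-trans (isRep y) (ℕP.≤-trans (ℕP.≤-reflexive ry≡ℓx) (isRep x)))))
                    (ℕP.<-irrefl ry≡ℓx)
                    ry≡ℓx

  arcAt : ∀ {j} s s′ → departs s ≡ j → arrives s′ ≡ suc j → Arc ℓ r (node s) (node s′) (colourAt j)
  arcAt s s′ refl arr≡ with consecutiveEndpoints (departsAtEnd s) (subst (EndpointOf (node s′)) arr≡ (arrivesAtEnd s′))
  ... | inj₁ (j≡ , ℓ′≡1+r) rewrite j≡ | colourAt-1+double (r (node s)) =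
    coverArc (subst (r (node s) ℕ.<_) (sym ℓ′≡1+r) (ℕP.n<1+n (r (node s)))) ℓ′≡1+r
  ... | inj₂ (j≡ , r′≡ℓ) rewrite j≡ | colourAt-double (ℓ (node s)) = sharpOrLoopArc r′≡ℓ

  Departing Arriving : ℕ → Set
  Departing j = Σ Station λ s → departs s ≡ j
  Arriving  j = Σ Station λ s → arrives s ≡ suc j

  edgeAt : ∀ j → Departing j → Arriving j → Edge
  edgeAt j (s , dep) (s′ , arr) = edge (node s) (node s′) (colourAt j) (arcAt s s′ dep arr)

  departTerm arriveTerm : Fin n → Station → ℤ
  departTerm z s = χodd (departs s) * δ (node s) z
  arriveTerm z s = χodd (arrives s) * δ (node s) z

  edgeVec-edgeAt : ∀ j (d : Departing j) (a : Arriving j) z →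
                   edgeVec (edgeAt j d a) z ≡ departTerm z (proj₁ d) + - arriveTerm z (proj₁ a)
  edgeVec-edgeAt j (s , refl) (s′ , arr) z =
    cong₂ (λ u v → u * δ (node s) z - v * δ (node s′) z) (isBlue-colourAt (departs s)) (trans (isRed-colourAt (departs s)) (cong χodd (sym arr)))

  select : (g : Station → ℕ) (j : ℕ) → List Station → List (Σ Station λ s → g s ≡ j)
  select g j []      = []
  select g j (s ∷ S) with g s ℕP.≟ j
  ... | yes gs≡j = (s , gs≡j) ∷ select g j S
  ... | no  _    = select g j S

  ∑ˡ-select : ∀ g j (f : Station → ℤ) S → ∑ˡ (f ∘ proj₁) (select g j S) ≡ ∑ˡ (λ s → χ≡ (g s) j * f s) S
  ∑ˡ-select g j f []      = refl
  ∑ˡ-select g j f (s ∷ S) with g s ℕP.≟ j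
  ... | yes refl = cong₂ _+_ (sym (trans (cong (_* f s) (χ≡-refl (g s))) (ℤP.*-identityˡ (f s)))) (∑ˡ-select g j f S)
  ... | no  gs≢j = begin
    ∑ˡ (f ∘ proj₁) (select g j S)                         ≡⟨ ∑ˡ-select g j f S ⟩
    rest                                                  ≡⟨ ℤP.+-identityˡ rest ⟨
    0ℤ + rest                                             ≡⟨ cong (_+ rest) (ℤP.*-zeroˡ (f s)) ⟨
    0ℤ * f s + rest                                       ≡⟨ cong (λ k → k * f s + rest) (χ≡-≢ gs≢j) ⟨
    χ≡ (g s) j * f s + rest                               ∎
    where
    open ≡-Reasoning
    rest = ∑ˡ (λ s → χ≡ (g s) j * f s) S

  count : (Station → ℕ) → ℕ → List Station → ℤ
  count g j = ∑ˡ (λ s → χ≡ (g s) j)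

  length-select : ∀ g j S → + length (select g j S) ≡ count g j S
  length-select g j S = begin
    + length (select g j S)                     ≡⟨ ∑ˡ-const-1 (select g j S) ⟨
    ∑ˡ (λ _ → 1ℤ) (select g j S)                ≡⟨ ∑ˡ-select g j (λ _ → 1ℤ) S ⟩
    ∑ˡ (λ s → χ≡ (g s) j * 1ℤ) S                ≡⟨ ∑ˡ-cong S (λ s → ℤP.*-identityʳ (χ≡ (g s) j)) ⟩
    count g j S                                 ∎
    where open ≡-Reasoning

  edgesAt : ℕ → List Station → List Edge
  edgesAt j S = zipWith (edgeAt j) (select departs j S) (select arrives (suc j) S)

  edgesBelow : ℕ → List Station → List Edge
  edgesBelow zero    S = []
  edgesBelow (suc B) S = edgesBelow B S ++ edgesAt B S

  Matched : ℕ → List Station → Set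
  Matched B S = ∀ j → j ℕ.< B → count departs j S ≡ count arrives (suc j) S

  Inside : ℕ → Station → Set
  Inside B s = departs s ℕ.< B × 0 ℕ.< arrives s × arrives s ℕ.≤ B

  module _ (F : Edge → ℤ) (f g : Station → ℤ) (F-edgeAt : ∀ j d a → F (edgeAt j d a) ≡ f (proj₁ d) + g (proj₁ a)) where

    private
      atCut : ℕ → Station → ℤ
      atCut j s = χ≡ (departs s) j * f s + χ≡ (arrives s) (suc j) * g s

    ∑ˡ-edgesAt : ∀ j S → count departs j S ≡ count arrives (suc j) S → ∑ˡ F (edgesAt j S) ≡ ∑ˡ (atCut j) S
    ∑ˡ-edgesAt j S matched = begin
      ∑ˡ F (edgesAt j S)
        ≡⟨ ∑ˡ-zipWith (edgeAt j) F (f ∘ proj₁) (g ∘ proj₁) (F-edgeAt j) (select departs j S) (select arrives (suc j) S) sameLength ⟩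
      ∑ˡ (f ∘ proj₁) (select departs j S) + ∑ˡ (g ∘ proj₁) (select arrives (suc j) S)
        ≡⟨ cong₂ _+_ (∑ˡ-select departs j f S) (∑ˡ-select arrives (suc j) g S) ⟩
      ∑ˡ (λ s → χ≡ (departs s) j * f s) S + ∑ˡ (λ s → χ≡ (arrives s) (suc j) * g s) S
        ≡⟨ ∑ˡ-distrib-+ (λ s → χ≡ (departs s) j * f s) (λ s → χ≡ (arrives s) (suc j) * g s) S ⟨
      ∑ˡ (atCut j) S
        ∎
      where
      open ≡-Reasoning
      sameLength = ℤP.+-injective (trans (length-select departs j S) (trans matched (sym (length-select arrives (suc j) S))))

    ∑ˡ-edgesBelow-by-cut : ∀ B S → Matched B S → ∑ˡ F (edgesBelow B S) ≡ ∑< B (λ j → ∑ˡ (atCut j) S)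
    ∑ˡ-edgesBelow-by-cut zero    S _       = refl
    ∑ˡ-edgesBelow-by-cut (suc B) S matched = trans (∑ˡ-++ F (edgesBelow B S) (edgesAt B S))
      (cong₂ _+_ (∑ˡ-edgesBelow-by-cut B S (λ j j<B → matched j (ℕP.m<n⇒m<1+n j<B))) (∑ˡ-edgesAt B S (matched B (ℕP.n<1+n B))))

    ∑<-atCut : ∀ B s → Inside B s → ∑< B (λ j → atCut j s) ≡ f s + g s
    ∑<-atCut B s (dep<B , 0<arr , arr≤B) = begin
      ∑< B (λ j → atCut j s)
        ≡⟨ ∑<-distrib-+ B (λ j → χ≡ (departs s) j * f s) (λ j → χ≡ (arrives s) (suc j) * g s) ⟩
      ∑< B (λ j → χ≡ (departs s) j * f s) + ∑< B (λ j → χ≡ (arrives s) (suc j) * g s)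
        ≡⟨ cong₂ _+_ (*-distribʳ-∑< B (χ≡ (departs s)) (f s)) (*-distribʳ-∑< B (χ≡ (arrives s) ∘ suc) (g s)) ⟩
      ∑< B (χ≡ (departs s)) * f s + ∑< B (χ≡ (arrives s) ∘ suc) * g s
        ≡⟨ cong₂ (λ u v → u * f s + v * g s) (∑<-χ≡ (departs s) B) (∑<-χ≡-suc (arrives s) B) ⟩
      χ< (departs s) B * f s + (χ< (arrives s) (suc B) - χ≡ (arrives s) 0) * g s
        ≡⟨ cong₂ (λ u v → u * f s + (v - χ≡ (arrives s) 0) * g s) (χ<-true dep<B) (χ<-true (s≤s arr≤B)) ⟩
      1ℤ * f s + (1ℤ - χ≡ (arrives s) 0) * g s
        ≡⟨ cong (λ v → 1ℤ * f s + (1ℤ - v) * g s) (χ≡-≢ (ℕP.<⇒≢ 0<arr ∘ sym)) ⟩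
      1ℤ * f s + (1ℤ - 0ℤ) * g s
        ≡⟨ cong₂ _+_ (ℤP.*-identityˡ (f s)) (ℤP.*-identityˡ (g s)) ⟩
      f s + g s
        ∎
      where open ≡-Reasoning

    ∑ˡ-edgesBelow : ∀ B S → Matched B S → All (Inside B) S → ∑ˡ F (edgesBelow B S) ≡ ∑ˡ (λ s → f s + g s) S
    ∑ˡ-edgesBelow B S matched inside = begin
      ∑ˡ F (edgesBelow B S)                         ≡⟨ ∑ˡ-edgesBelow-by-cut B S matched ⟩
      ∑< B (λ j → ∑ˡ (atCut j) S)                   ≡⟨ ∑<-∑ˡ B atCut S ⟩
      ∑ˡ (λ s → ∑< B (λ j → atCut j s)) S           ≡⟨ ∑ˡ-All-cong S inside (∑<-atCut B) ⟩
      ∑ˡ (λ s → f s + g s) S                        ∎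
      where open ≡-Reasoning

  edgesBelow-balanced : ∀ B S → Matched B S → All (Inside B) S → Balanced (edgesBelow B S)
  edgesBelow-balanced B S matched inside v = begin
    outDeg v (edgesBelow B S)                ≡⟨ ∑ˡ-edgesBelow (λ e → δ (src e) v) (λ s → δ (node s) v) (λ _ → 0ℤ) (λ _ _ _ → sym (ℤP.+-identityʳ _)) B S matched inside ⟩
    ∑ˡ (λ s → δ (node s) v + 0ℤ) S           ≡⟨ ∑ˡ-cong S (λ s → trans (ℤP.+-identityʳ (δ (node s) v)) (sym (ℤP.+-identityˡ (δ (node s) v)))) ⟩
    ∑ˡ (λ s → 0ℤ + δ (node s) v) S           ≡⟨ ∑ˡ-edgesBelow (λ e → δ (tgt e) v) (λ _ → 0ℤ) (λ s → δ (node s) v) (λ _ _ _ → sym (ℤP.+-identityˡ _)) B S matched inside ⟨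
    inDeg v (edgesBelow B S)                 ∎
    where open ≡-Reasoning

  ∑ˡ-edgeVec-edgesBelow : ∀ B S → Matched B S → All (Inside B) S →
                          ∀ z → ∑ˡ (λ e → edgeVec e z) (edgesBelow B S) ≡ ∑ˡ (λ s → departTerm z s + - arriveTerm z s) S
  ∑ˡ-edgeVec-edgesBelow B S matched inside z =
    ∑ˡ-edgesBelow (λ e → edgeVec e z) (departTerm z) (λ s → - arriveTerm z s) (λ j d a → edgeVec-edgeAt j d a z) B S matched inside

-- The cycle decomposition of a bounded objective

module Construction {n} {ℓ r : Fin n → ℕ} (canonical : IsCanonical ℓ r) (c : Fin n → ℤ) where
  open Cut ℓ r c using (exit; entry; μ; cut)
  open Stations ℓ r (proj₁ canonical)
  open EdgeLists ℓ r

  m : ℕ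
  m = proj₁ (proj₂ canonical)

  private
    endpoints = proj₁ (proj₂ (proj₂ canonical))

  B : ℕ
  B = ℕ.pred (double m)

  exit-isEndpoint : ∀ x → EndpointOf x (exit x)
  exit-isEndpoint x with c x
  ... | + _      = inj₂ refl
  ... | -[1+ _ ] = inj₁ refl

  entry-isEndpoint : ∀ x → EndpointOf x (entry x)
  entry-isEndpoint x with c x
  ... | + _      = inj₁ refl
  ... | -[1+ _ ] = inj₂ refl

  endpoint<2m : ∀ {x P} → EndpointOf x P → P ℕ.< double m
  endpoint<2m {x} (inj₁ refl) = ℕP.≤-trans (ℕP.n≤1+n _) (double-mono-≤ (proj₁ (proj₁ endpoints x)))
  endpoint<2m {x} (inj₂ refl) = double-mono-≤ (proj₂ (proj₁ endpoints x))

  eventStation : Fin n → Station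
  eventStation x = station x (exit x) (entry x) (exit-isEndpoint x) (entry-isEndpoint x)

  endpointAt : ∀ P → P ℕ.< double m → ∃ λ v → EndpointOf v P
  endpointAt P P<2m with parity P
  ... | even k = let v , ℓv≡k = canonical⇒leftEndpoint canonical k (double-<-cancel P<2m)
                 in v , inj₁ (cong double (sym ℓv≡k))
  ... | odd  k = let v , rv≡k = canonical⇒rightEndpoint canonical k (1+double-<-cancel P<2m)
                 in v , inj₂ (cong (suc ∘ double) (sym rv≡k))

  hubStation : ∀ P → P ℕ.< double m → Station
  hubStation P P<2m = station v P P atP atP
    where
    v   = proj₁ (endpointAt P P<2m)
    atP = proj₂ (endpointAt P P<2m)

  hubCount : ℕ → ℕ
  hubCount P = ℤ.∣ cut P ∣

  stations : List Station
  stations = replicateEach μ eventStation ++ replicateBelow (double m) hubCount hubStation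

  cut-0 : cut 0 ≡ - ∑ℤ (λ x → + μ x * χ< (entry x) 1)
  cut-0 = trans (∑-cong (λ x → u*[0-e]≡-[u*e] (+ μ x) (χ< (entry x) 1))) (∑-distrib-neg (λ x → + μ x * χ< (entry x) 1))
    where
    u*[0-e]≡-[u*e] : ∀ u e → u * (0ℤ - e) ≡ - (u * e)
    u*[0-e]≡-[u*e] = solve-∀

  cut-B : cut B ≡ - ∑ℤ (λ x → + μ x * (1ℤ - χ< (exit x) B))
  cut-B = trans (∑-cong (λ x → trans (cong (λ e → + μ x * (χ< (exit x) B - e)) (χ<-true (s≤s (ℕP.<⇒≤pred (endpoint<2m (entry-isEndpoint x))))))
                                     (u*[a-1]≡-[u*[1-a]] (+ μ x) (χ< (exit x) B))))
                (∑-distrib-neg (λ x → + μ x * (1ℤ - χ< (exit x) B)))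
    where
    u*[a-1]≡-[u*[1-a]] : ∀ u a → u * (a - 1ℤ) ≡ - (u * (1ℤ - a))
    u*[a-1]≡-[u*[1-a]] = solve-∀

  departures arrivals : ℕ → ℤ
  departures j = ∑ℤ (λ x → + μ x * χ≡ (exit x) j)
  arrivals   j = ∑ℤ (λ x → + μ x * χ≡ (entry x) j)

  cut-step : ∀ j → cut (suc j) ≡ cut j + (departures j - arrivals (suc j))
  cut-step j = begin
    cut (suc j)
      ≡⟨ ∑-cong (λ x → cong₂ (λ a e → + μ x * (a - e)) (χ<-suc (exit x) j) (χ<-suc (entry x) (suc j))) ⟩
    ∑ℤ (λ x → + μ x * ((χ< (exit x) j + χ≡ (exit x) j) - (χ< (entry x) (suc j) + χ≡ (entry x) (suc j))))
      ≡⟨ ∑-cong (λ x → split (+ μ x) (χ< (exit x) j) (χ≡ (exit x) j) (χ< (entry x) (suc j)) (χ≡ (entry x) (suc j))) ⟩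
    ∑ℤ (λ x → cutTerm x + (departing x - arriving x))
      ≡⟨ ∑-distrib-+ cutTerm (λ x → departing x - arriving x) ⟩
    cut j + ∑ℤ (λ x → departing x - arriving x)
      ≡⟨ cong (_+_ (cut j)) (∑-distrib-minus departing arriving) ⟩
    cut j + (departures j - arrivals (suc j))
      ∎
    where
    open ≡-Reasoning
    cutTerm departing arriving : Fin n → ℤ
    cutTerm   x = + μ x * (χ< (exit x) j - χ< (entry x) (suc j))
    departing x = + μ x * χ≡ (exit x) j
    arriving  x = + μ x * χ≡ (entry x) (suc j)
    split : ∀ u a b d e → u * ((a + b) - (d + e)) ≡ u * (a - d) + (u * b - u * e)
    split = solve-∀

  private
    pred<self : ∀ {P k} → P ℕ.< k → ℕ.pred k ℕ.< k
    pred<self {k = suc k} _ = ℕP.n<1+n k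

    <pred⇒suc< : ∀ {j k} → j ℕ.< ℕ.pred k → suc j ℕ.< k
    <pred⇒suc< {k = suc k} j<k = s≤s j<k

    +*-nonNeg : ∀ k {a} → 0ℤ ≤ a → 0ℤ ≤ + k * a
    +*-nonNeg k {a} 0≤a = subst (_≤ + k * a) (ℤP.*-zeroʳ (+ k)) (ℤP.*-monoˡ-≤-nonNeg (+ k) 0≤a)

    -∑-nonPos : ∀ (t : Fin n → ℤ) → (∀ x → 0ℤ ≤ t x) → - ∑ℤ t ≤ 0ℤ
    -∑-nonPos t t≥0 = ℤP.neg-mono-≤ (∑-nonNeg t≥0)

    -∑-nonNeg⇒vanish : ∀ (t : Fin n → ℤ) → (∀ x → 0ℤ ≤ t x) → 0ℤ ≤ - ∑ℤ t → ∀ x → t x ≡ 0ℤ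
    -∑-nonNeg⇒vanish t t≥0 0≤-∑t =
      ∑-nonNeg-≤0⇒≡0 t≥0 (subst (_≤ 0ℤ) (ℤP.neg-involutive (∑ℤ t)) (ℤP.neg-mono-≤ 0≤-∑t))

  module _ (cut≥0 : ∀ P → P ℕ.< double m → 0ℤ ≤ cut P) where

    private
      entryWeight exitWeight : Fin n → ℤ
      entryWeight x = + μ x * χ< (entry x) 1
      exitWeight  x = + μ x * (1ℤ - χ< (exit x) B)

      entryWeight≥0 : ∀ x → 0ℤ ≤ entryWeight x
      entryWeight≥0 x = +*-nonNeg (μ x) (χ<-nonNeg (entry x) 1)
      exitWeight≥0 : ∀ x → 0ℤ ≤ exitWeight x
      exitWeight≥0  x = +*-nonNeg (μ x) (ℤP.i≤j⇒0≤j-i (χ<-≤1 (exit x) B))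

      nonPositiveCut⇒noHubs : ∀ {P} → P ℕ.< double m → cut P ≤ 0ℤ → hubCount P ≡ 0
      nonPositiveCut⇒noHubs {P} P<2m cut≤0 = ℤP.+-injective (trans (ℤP.0≤i⇒+∣i∣≡i (cut≥0 P P<2m)) (ℤP.≤-antisym cut≤0 (cut≥0 P P<2m)))

    0<entry : ∀ x → μ x ≡ 0 ⊎ 0 ℕ.< entry x
    0<entry x with ℤP.i*j≡0⇒i≡0∨j≡0 (+ μ x) (-∑-nonNeg⇒vanish entryWeight entryWeight≥0 0≤-∑ x)
      where
      0≤-∑ = subst (0ℤ ≤_) cut-0 (cut≥0 0 (ℕP.m<n⇒0<n (endpoint<2m (entry-isEndpoint x))))
    ... | inj₁ μ≡0   = inj₁ (ℤP.+-injective μ≡0)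
    ... | inj₂ χ<≡0 = inj₂ (χ<≡0⇒≥ χ<≡0)

    exit<B : ∀ x → μ x ≡ 0 ⊎ exit x ℕ.< B
    exit<B x with ℤP.i*j≡0⇒i≡0∨j≡0 (+ μ x) (-∑-nonNeg⇒vanish exitWeight exitWeight≥0 0≤-∑ x)
      where
      0≤-∑ = subst (0ℤ ≤_) cut-B (cut≥0 B (pred<self (endpoint<2m (exit-isEndpoint x))))
    ... | inj₁ μ≡0   = inj₁ (ℤP.+-injective μ≡0)
    ... | inj₂ 1-χ≡0 = inj₂ (χ<≡1⇒< (trans (a≡1-[1-a] (χ< (exit x) B)) (cong (_-_ 1ℤ) 1-χ≡0)))
      where
      a≡1-[1-a] : ∀ a → a ≡ 1ℤ - (1ℤ - a)
      a≡1-[1-a] = solve-∀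

    eventInside : ∀ x → μ x ≡ 0 ⊎ Inside B (eventStation x)
    eventInside x with 0<entry x | exit<B x
    ... | inj₁ μ≡0    | _           = inj₁ μ≡0
    ... | _           | inj₁ μ≡0    = inj₁ μ≡0
    ... | inj₂ 0<entry | inj₂ exit<B = inj₂ (exit<B , 0<entry , ℕP.<⇒≤pred (endpoint<2m (entry-isEndpoint x)))

    hubInside : ∀ P P<2m → hubCount P ≡ 0 ⊎ Inside B (hubStation P P<2m)
    hubInside P P<2m with P ℕP.≟ 0 | P ℕP.≟ B
    ... | yes refl | _        = inj₁ (nonPositiveCut⇒noHubs P<2m (subst (_≤ 0ℤ) (sym cut-0) (-∑-nonPos entryWeight entryWeight≥0)))
    ... | no  _    | yes refl = inj₁ (nonPositiveCut⇒noHubs P<2m (subst (_≤ 0ℤ) (sym cut-B) (-∑-nonPos exitWeight exitWeight≥0)))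
    ... | no  P≢0  | no  P≢B  = inj₂ (ℕP.≤∧≢⇒< (ℕP.<⇒≤pred P<2m) P≢B , ℕP.n≢0⇒n>0 P≢0 , ℕP.<⇒≤pred P<2m)

    allInside : All (Inside B) stations
    allInside = AllP.++⁺ (All-replicateEach μ eventStation eventInside) (All-replicateBelow (double m) hubCount hubStation hubInside)

    count-stations : ∀ (g : Station → ℕ) → (∀ P P<2m → g (hubStation P P<2m) ≡ P) → ∀ j → j ℕ.< double m →
                     count g j stations ≡ ∑ℤ (λ x → + μ x * χ≡ (g (eventStation x)) j) + cut j
    count-stations g g-hub j j<2m = begin
      count g j stations
        ≡⟨ ∑ˡ-++ (λ s → χ≡ (g s) j) (replicateEach μ eventStation) (replicateBelow (double m) hubCount hubStation) ⟩
      count g j (replicateEach μ eventStation) + count g j (replicateBelow (double m) hubCount hubStation)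
        ≡⟨ cong₂ _+_ (∑ˡ-replicateEach (λ s → χ≡ (g s) j) μ eventStation)
                     (∑ˡ-replicateBelow (λ s → χ≡ (g s) j) (λ P → χ≡ P j) (double m) hubCount hubStation (λ P P<2m → cong (λ p → χ≡ p j) (g-hub P P<2m))) ⟩
      ∑ℤ (λ x → + μ x * χ≡ (g (eventStation x)) j) + ∑< (double m) (λ P → + hubCount P * χ≡ P j)
        ≡⟨ cong (_+_ eventCount) (∑<-pick (double m) j (λ P → + hubCount P)) ⟩
      ∑ℤ (λ x → + μ x * χ≡ (g (eventStation x)) j) + χ< j (double m) * + hubCount j
        ≡⟨ cong (_+_ eventCount) (trans (cong (_* + hubCount j) (χ<-true j<2m)) (trans (ℤP.*-identityˡ _) (ℤP.0≤i⇒+∣i∣≡i (cut≥0 j j<2m)))) ⟩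
      ∑ℤ (λ x → + μ x * χ≡ (g (eventStation x)) j) + cut j
        ∎
      where
      open ≡-Reasoning
      eventCount = ∑ℤ (λ x → + μ x * χ≡ (g (eventStation x)) j)

    matched : Matched B stations
    matched j j<B = begin
      count departs j stations               ≡⟨ count-stations departs (λ _ _ → refl) j (ℕP.<-trans (ℕP.n<1+n j) 1+j<2m) ⟩
      departures j + cut j                   ≡⟨ shuffle (departures j) (arrivals (suc j)) (cut j) ⟩
      arrivals (suc j) + (cut j + (departures j - arrivals (suc j)))
                                             ≡⟨ cong (_+_ (arrivals (suc j))) (cut-step j) ⟨
      arrivals (suc j) + cut (suc j)         ≡⟨ count-stations arrives (λ _ _ → refl) (suc j) 1+j<2m ⟨
      count arrives (suc j) stations         ∎
      where
      open ≡-Reasoning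
      1+j<2m = <pred⇒suc< j<B
      shuffle : ∀ d a k → d + k ≡ a + (k + (d - a))
      shuffle = solve-∀

    ∑ˡ-stationTerms : ∀ z → ∑ˡ (λ s → departTerm z s + - arriveTerm z s) stations ≡ c z
    ∑ˡ-stationTerms z = begin
      ∑ˡ term stations
        ≡⟨ ∑ˡ-++ term (replicateEach μ eventStation) (replicateBelow (double m) hubCount hubStation) ⟩
      ∑ˡ term (replicateEach μ eventStation) + ∑ˡ term (replicateBelow (double m) hubCount hubStation)
        ≡⟨ cong₂ _+_ (∑ˡ-replicateEach term μ eventStation)
                     (∑ˡ-replicateBelow term (λ _ → 0ℤ) (double m) hubCount hubStation (λ P P<2m → ℤP.+-inverseʳ (departTerm z (hubStation P P<2m)))) ⟩
      ∑ℤ (λ x → + μ x * term (eventStation x)) + ∑< (double m) (λ P → + hubCount P * 0ℤ)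
        ≡⟨ cong₂ _+_ (∑-cong eventTerm) (trans (∑<-cong (double m) (λ P → ℤP.*-zeroʳ (+ hubCount P))) (∑<-zero (double m))) ⟩
      ∑ℤ (λ x → c x * δ x z) + 0ℤ
        ≡⟨ trans (ℤP.+-identityʳ _) (∑-δ′ z c) ⟩
      c z
        ∎
      where
      open ≡-Reasoning
      term : Station → ℤ
      term s = departTerm z s + - arriveTerm z s
      eventTerm : ∀ x → + μ x * term (eventStation x) ≡ c x * δ x z
      eventTerm x with c x
      ... | + k      = trans (cong₂ (λ a e → + k * (a * δ x z + - (e * δ x z))) (χodd-1+double (r x)) (χodd-double (ℓ x)))
                             (positive (+ k) (δ x z))
        where
        positive : ∀ u d → u * (1ℤ * d + - (0ℤ * d)) ≡ u * d
        positive = solve-∀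
      ... | -[1+ k ] = trans (cong₂ (λ a e → + suc k * (a * δ x z + - (e * δ x z))) (χodd-double (ℓ x)) (χodd-1+double (r x)))
                             (negative (+ suc k) (δ x z))
        where
        negative : ∀ u d → u * (0ℤ * d + - (1ℤ * d)) ≡ - u * d
        negative = solve-∀

    nonNegativeCuts⇒cycleSum : ∃ λ (Cs : List (Cycle ℓ r)) → RowSum (cycleSystem ℓ r) Cs c
    nonNegativeCuts⇒cycleSum =
      Cs , λ z → trans (sums z) (trans (∑ˡ-edgeVec-edgesBelow B stations matched allInside z) (∑ˡ-stationTerms z))
      where
      decomposition = balanced⇒cycleSum (edgesBelow B stations) (edgesBelow-balanced B stations matched allInside)
      Cs   = proj₁ decomposition
      sums = proj₂ decomposition

bounded⇒cycleSum : ∀ {n} {ℓ r : Fin n → ℕ} → IsCanonical ℓ r → ∀ c → MaxFinite (cycleSystem ℓ r) c →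
                   ∃ λ (Cs : List (Cycle ℓ r)) → RowSum (cycleSystem ℓ r) Cs c
bounded⇒cycleSum {ℓ = ℓ} {r} canonical c bounded with ℕP.anyUpTo? (λ P → cut P ℤP.<? 0ℤ) (double m)
  where
  open Cut ℓ r c using (cut)
  open Construction canonical c using (m)
... | yes (P , _ , cut<0) = ⊥-elim (Cut.cut<0⇒unbounded ℓ r c P cut<0 bounded)
... | no  noNegativeCut   = Construction.nonNegativeCuts⇒cycleSum canonical c
                              (λ P P<2m → ℤP.≮⇒≥ (λ cut<0 → noNegativeCut (P , P<2m , cut<0)))

proposition3p3 : (n : ℕ) (ℓ r : Fin n → ℕ) → IsCanonical ℓ r →
    TotallyDualIntegral (cycleSystem ℓ r)
proposition3p3 n ℓ r canonical =
  tight∧rowSums⇒TDI (cycleSystem ℓ r) intervalLength-tight (bounded⇒cycleSum canonical)
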